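{- Let $G$ be a finite group and $H$ a subgroup of $G$. If $H$ is not DS, then $G$ is not DS; and if $H$ is not Cay-DS, then $G$ is not Cay-DS. In particular, the classes of finite DS groups and of finite Cay-DS groups are closed under taking subgroups.
   Context: For a finite group $G$ and a subset $S\subseteq G\setminus\{1\}$ with $S=S^{ -1}$, the Cayley graph $Cay(G,S)$ has vertex set $G$, with $a,b$ adjacent iff $ab^{ -1}\in S$. The spectrum of a graph is the multiset of eigenvalues of its adjacency matrix. A finite group $G$ is DS if every Cayley graph $\Gamma$ on $G$ is isomorphic to every (finite simple) graph $\Gamma'$ with the same spectrum as $\Gamma$. A finite group $G$ is Cay-DS if every Cayley graph $\Gamma$ on $G$ is isomorphic to every Cayley graph $\Gamma'$ (on any finite group) with the same spectrum as $\Gamma$. -}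

module Defs where

open import Data.Nat as ℕ using (ℕ; zero; suc)
open import Data.Fin using (Fin; zero; suc; punchIn)
open import Data.Bool using (Bool; true; false; if_then_else_)
open import Data.Integer as ℤ using (ℤ; +_; -_)
open import Data.Product using (Σ; _×_; _,_; ∃)
open import Function using (Injective)
open import Function.Bundles using (_↔_; Inverse)
open import Relation.Binary.PropositionalEquality using (_≡_)
open import Relation.Nullary using (¬_)
open import Algebra.Structures using (IsGroup)

-- Finite groups: a group structure on Fin order (every finite group is
-- isomorphic to one of these).

record FinGroup : Set where
  field
    order   : ℕ
    _∙_     : Fin order → Fin order → Fin order
    ε       : Fin order
    _⁻¹     : Fin order → Fin order
    isGroup : IsGroup _≡_ _∙_ ε _⁻¹

open FinGroup public using (order)

-- H is (isomorphic to) a subgroup of G: an injective group homomorphism H → G.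
record SubgroupEmbedding (H G : FinGroup) : Set where
  private
    module H = FinGroup H
    module G = FinGroup G
  field
    φ         : Fin (order H) → Fin (order G)
    injective : Injective _≡_ _≡_ φ
    hom       : ∀ x y → φ (x H.∙ y) ≡ φ x G.∙ φ y

Graph : ℕ → Set
Graph n = Fin n → Fin n → Bool

IsSimple : ∀ {n} → Graph n → Set
IsSimple {n} A = (∀ i j → A i j ≡ A j i) × (∀ i → A i i ≡ false)

_≅_ : ∀ {n m} → Graph n → Graph m → Set
_≅_ {n} {m} A B = Σ (Fin n ↔ Fin m) λ σ →
  ∀ i j → B (Inverse.to σ i) (Inverse.to σ j) ≡ A i j

IsConnectionSet : (G : FinGroup) → (Fin (order G) → Bool) → Set
IsConnectionSet G S = (S ε ≡ false) × (∀ g → S (g ⁻¹) ≡ S g)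
  where open FinGroup G

Cay : (G : FinGroup) → (Fin (order G) → Bool) → Graph (order G)
Cay G S a b = S (a ∙ (b ⁻¹))
  where open FinGroup G

sumFin : ∀ {n} → (Fin n → ℤ) → ℤ
sumFin {zero}  f = + 0
sumFin {suc n} f = f zero ℤ.+ sumFin (λ i → f (suc i))

sign : ℕ → ℤ
sign zero          = + 1
sign (suc zero)    = - (+ 1)
sign (suc (suc k)) = sign k

det : ∀ {n} → (Fin n → Fin n → ℤ) → ℤ
det {zero}  M = + 1
det {suc n} M = sumFin {suc n} λ j →
  sign (Data.Fin.toℕ j) ℤ.* (M zero j ℤ.* det (λ i k → M (suc i) (punchIn j k)))

adjMatrix : ∀ {n} → Graph n → Fin n → Fin n → ℤ
adjMatrix A i j = if A i j then + 1 else + 0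

δ : ∀ {n} → Fin n → Fin n → ℤ
δ zero    zero    = + 1
δ zero    (suc j) = + 0
δ (suc i) zero    = + 0
δ (suc i) (suc j) = δ i j

charPoly : ∀ {n} → Graph n → ℤ → ℤ
charPoly A x = det (λ i j → (x ℤ.* δ i j) ℤ.- adjMatrix A i j)

-- same spectrum (same multiset of eigenvalues of the adjacency matrices)
-- = same number of vertices and same characteristic polynomial
Cospectral : ∀ {n m} → Graph n → Graph m → Set
Cospectral {n} {m} A B = (n ≡ m) × (∀ x → charPoly A x ≡ charPoly B x)

DS : FinGroup → Set
DS G = ∀ (S : Fin (order G) → Bool) → IsConnectionSet G S →
       ∀ m (Γ' : Graph m) → IsSimple Γ' → Cospectral (Cay G S) Γ' → Cay G S ≅ Γ'

CayDS : FinGroup → Set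
CayDS G = ∀ (S : Fin (order G) → Bool) → IsConnectionSet G S →
          ∀ (K : FinGroup) (T : Fin (order K) → Bool) → IsConnectionSet K T →
          Cospectral (Cay G S) (Cay K T) → Cay G S ≅ Cay K T

{-# OPTIONS --safe #-}
module Submission where

open import Defs
open import Data.Product using (_×_; _,_)
open import Relation.Nullary using (¬_)
open import Data.Bool using (Bool)
open import Data.Fin using (Fin)
open import Data.Nat using (ℕ; NonZero)
open import Level using (0ℓ)
open import Relation.Nullary.Negation using (contraposition)
open import Relation.Unary using (Pred; Decidable)

-- Let H ≤ G have index k and let Cay(H,S) be cospectral with a graph Γ. Read inside G, S gives
-- a Cayley graph Cay(G,S) which is k disjoint copies of Cay(H,S), one on each right coset of H.
-- Characteristic polynomials multiply over disjoint unions, so Cay(G,S) is cospectral with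
-- Γ ⊕ (k−1)·Cay(H,S); if G is DS the two are isomorphic, and cancelling the common summand
-- (along the first-return map of the isomorphism) gives Cay(H,S) ≅ Γ.
-- If Γ = Cay(K,T), then k·Γ is itself a Cayley graph, of ℤ/k × K, so if G is Cay-DS we get
-- k·Cay(H,S) ≅ k·Cay(K,T). A Cayley graph is a disjoint union of copies of its connected
-- component, the Cayley graph of ⟨S⟩; an isomorphism of disjoint unions of copies of connected
-- graphs matches the components, and counting vertices gives Cay(H,S) ≅ Cay(K,T).

module Determinant where
  open import Data.Nat as ℕ using (zero; suc)
  open import Data.Fin using (zero; suc; punchIn; punchOut; toℕ; _↑ˡ_; _↑ʳ_; lift)
  import Data.Fin.Properties as Finₚ
  open import Data.Integer using (ℤ; +_; -_; _+_; _*_)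
  import Data.Integer.Properties as ℤₚ
  open import Data.Integer.Solver using (module +-*-Solver)
  open +-*-Solver
  open import Data.Product using (Σ; _×_; _,_; proj₁; proj₂)
  open import Function using (Injective)
  open import Relation.Binary.PropositionalEquality
  open ≡-Reasoning

  Matrix : ℕ → Set
  Matrix n = Fin n → Fin n → ℤ

  _ᵀ : ∀ {n} → Matrix n → Matrix n
  (M ᵀ) i j = M j i

  minor : ∀ {n} → Matrix (suc n) → Fin (suc n) → Matrix n
  minor M j i k = M (suc i) (punchIn j k)

  sumFin-cong : ∀ {n} {f g : Fin n → ℤ} → (∀ i → f i ≡ g i) → sumFin f ≡ sumFin g
  sumFin-cong {zero}  eq = refl
  sumFin-cong {suc n} eq = cong₂ _+_ (eq zero) (sumFin-cong (λ i → eq (suc i)))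

  sumFin-zero : ∀ {n} → sumFin {n} (λ _ → + 0) ≡ + 0
  sumFin-zero {zero}  = refl
  sumFin-zero {suc n} = trans (ℤₚ.+-identityˡ _) (sumFin-zero {n})

  sumFin-distrib-+ : ∀ {n} (f g : Fin n → ℤ) → sumFin (λ i → f i + g i) ≡ sumFin f + sumFin g
  sumFin-distrib-+ {zero}  f g = refl
  sumFin-distrib-+ {suc n} f g = trans (cong (_+_ (f zero + g zero)) (sumFin-distrib-+ (λ i → f (suc i)) (λ i → g (suc i))))
    (solve 4 (λ a b c d → (a :+ b) :+ (c :+ d) := (a :+ c) :+ (b :+ d)) refl (f zero) (g zero) _ _)

  *-distribˡ-sumFin : ∀ {n} c (f : Fin n → ℤ) → c * sumFin f ≡ sumFin (λ i → c * f i)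
  *-distribˡ-sumFin {zero}  c f = ℤₚ.*-zeroʳ c
  *-distribˡ-sumFin {suc n} c f =
    trans (ℤₚ.*-distribˡ-+ c _ _) (cong (_+_ (c * f zero)) (*-distribˡ-sumFin c (λ i → f (suc i))))

  *-distribʳ-sumFin : ∀ {n} c (f : Fin n → ℤ) → sumFin f * c ≡ sumFin (λ i → f i * c)
  *-distribʳ-sumFin c f = trans (ℤₚ.*-comm _ c) (trans (*-distribˡ-sumFin c f) (sumFin-cong (λ i → ℤₚ.*-comm c (f i))))

  neg-distrib-sumFin : ∀ {n} (f : Fin n → ℤ) → - sumFin f ≡ sumFin (λ i → - f i)
  neg-distrib-sumFin {zero}  f = refl
  neg-distrib-sumFin {suc n} f =
    trans (ℤₚ.neg-distrib-+ (f zero) _) (cong (_+_ (- f zero)) (neg-distrib-sumFin (λ i → f (suc i))))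

  sumFin-comm : ∀ {m n} (f : Fin m → Fin n → ℤ) →
    sumFin (λ i → sumFin (f i)) ≡ sumFin (λ j → sumFin (λ i → f i j))
  sumFin-comm {zero}  {n} f = sym (sumFin-zero {n})
  sumFin-comm {suc m} f = trans (cong (_+_ (sumFin (f zero))) (sumFin-comm (λ i → f (suc i))))
    (sym (sumFin-distrib-+ (f zero) (λ j → sumFin (λ i → f (suc i) j))))

  sumFin-++ : ∀ a b (f : Fin (a ℕ.+ b) → ℤ) →
    sumFin f ≡ sumFin (λ i → f (i ↑ˡ b)) + sumFin (λ j → f (a ↑ʳ j))
  sumFin-++ zero    b f = sym (ℤₚ.+-identityˡ _)
  sumFin-++ (suc a) b f =
    trans (cong (_+_ (f zero)) (sumFin-++ a b (λ i → f (suc i)))) (sym (ℤₚ.+-assoc (f zero) _ _))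

  sign-suc : ∀ n → sign (suc n) ≡ - sign n
  sign-suc zero          = refl
  sign-suc (suc zero)    = refl
  sign-suc (suc (suc n)) = sign-suc n

  sign-sq : ∀ n → sign n * sign n ≡ + 1
  sign-sq zero          = refl
  sign-sq (suc zero)    = refl
  sign-sq (suc (suc n)) = sign-sq n

  det-cong : ∀ {n} {M N : Matrix n} → (∀ i j → M i j ≡ N i j) → det M ≡ det N
  det-cong {zero}  eq = refl
  det-cong {suc n} eq = sumFin-cong λ j →
    cong₂ (λ a d → sign (toℕ j) * (a * d)) (eq zero j) (det-cong (λ i k → eq (suc i) (punchIn j k)))

  TransposeInvariant : ℕ → Set
  TransposeInvariant n = ∀ (M : Matrix n) → det (M ᵀ) ≡ det M

  -- det M expanded along the first row, and each minor along its first column: for matrices of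
  -- smaller size transposition is already known to preserve det, and this form is symmetric.
  module DoubleExpansion {n} (M : Matrix (suc (suc n))) where
    minor₂ : Fin (suc n) → Fin (suc n) → ℤ
    minor₂ i j = det (λ a b → M (suc (punchIn i a)) (suc (punchIn j b)))

    term : Fin (suc n) → Fin (suc n) → ℤ
    term j i = - (sign (toℕ j) * sign (toℕ i)) * (M zero (suc j) * M (suc i) zero * minor₂ i j)

    expansion : ℤ
    expansion = M zero zero * det (minor M zero) + sumFin (λ j → sumFin (term j))

    det≡expansion : TransposeInvariant (suc n) → TransposeInvariant n → det M ≡ expansion
    det≡expansion ih₁ ih₀ = cong₂ _+_ (ℤₚ.*-identityˡ (M zero zero * det (minor M zero))) (sumFin-cong column)
      where
      column : ∀ j → sign (toℕ (suc j)) * (M zero (suc j) * det (minor M (suc j))) ≡ sumFin (term j)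
      column j = begin
          sign (suc (toℕ j)) * (M zero (suc j) * det (minor M (suc j)))
        ≡⟨ cong₂ (λ s d → s * (M zero (suc j) * d)) (sign-suc (toℕ j)) (sym (ih₁ (minor M (suc j)))) ⟩
          - sign (toℕ j) * (M zero (suc j) * sumFin (λ i → sign (toℕ i) * (M (suc i) zero * det (minor (minor M (suc j) ᵀ) i))))
        ≡⟨ cong (λ x → - sign (toℕ j) * (M zero (suc j) * x))
             (sumFin-cong (λ i → cong (λ d → sign (toℕ i) * (M (suc i) zero * d))
               (ih₀ (λ a b → M (suc (punchIn i a)) (suc (punchIn j b)))))) ⟩
          - sign (toℕ j) * (M zero (suc j) * sumFin (λ i → sign (toℕ i) * (M (suc i) zero * minor₂ i j)))
        ≡⟨ trans (cong (- sign (toℕ j) *_) (*-distribˡ-sumFin (M zero (suc j)) inner))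
             (*-distribˡ-sumFin (- sign (toℕ j)) (λ i → M zero (suc j) * inner i)) ⟩
          sumFin (λ i → - sign (toℕ j) * (M zero (suc j) * (sign (toℕ i) * (M (suc i) zero * minor₂ i j))))
        ≡⟨ sumFin-cong (λ i → solve 5 (λ sj si a b d → (:- sj) :* (a :* (si :* (b :* d))) := (:- (sj :* si)) :* (a :* b :* d))
             refl (sign (toℕ j)) (sign (toℕ i)) (M zero (suc j)) (M (suc i) zero) (minor₂ i j)) ⟩
          sumFin (term j)
        ∎
        where
        inner : Fin (suc n) → ℤ
        inner i = sign (toℕ i) * (M (suc i) zero * minor₂ i j)

  transpose-step : ∀ {n} → TransposeInvariant (suc n) → TransposeInvariant n → TransposeInvariant (suc (suc n))
  transpose-step ih₁ ih₀ M = begin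
      det (M ᵀ)                 ≡⟨ Mᵀ.det≡expansion ih₁ ih₀ ⟩
      Mᵀ.expansion              ≡⟨ cong₂ _+_ (cong (M zero zero *_) (ih₁ (minor M zero))) swapped ⟩
      M.expansion               ≡⟨ M.det≡expansion ih₁ ih₀ ⟨
      det M                     ∎
    where
    module M  = DoubleExpansion M
    module Mᵀ = DoubleExpansion (M ᵀ)
    swapped : sumFin (λ j → sumFin (Mᵀ.term j)) ≡ sumFin (λ j → sumFin (M.term j))
    swapped = trans (sumFin-cong λ j → sumFin-cong λ i → trans
        (cong (λ d → - (sign (toℕ j) * sign (toℕ i)) * (M (suc j) zero * M zero (suc i) * d))
          (ih₀ (λ a b → M (suc (punchIn j a)) (suc (punchIn i b)))))
        (solve 5 (λ sj si a b d → (:- (sj :* si)) :* (a :* b :* d) := (:- (si :* sj)) :* (b :* a :* d))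
          refl (sign (toℕ j)) (sign (toℕ i)) (M (suc j) zero) (M zero (suc i)) (M.minor₂ j i)))
      (sumFin-comm (λ j i → M.term i j))

  det-transpose : ∀ n → TransposeInvariant n
  det-transpose zero          M = refl
  det-transpose (suc zero)    M = refl
  det-transpose (suc (suc n))   = transpose-step (det-transpose (suc n)) (det-transpose n)

  swap01 : ∀ {n} → Fin (suc (suc n)) → Fin (suc (suc n))
  swap01 zero          = suc zero
  swap01 (suc zero)    = zero
  swap01 (suc (suc i)) = suc (suc i)

  det-swapColumns01 : ∀ n (M : Matrix (suc (suc n))) → det (λ i j → M i (swap01 j)) ≡ - det M
  det-swapColumns01 n M = begin
      det M′
    ≡⟨ cong₂ _+_ (cong (λ d → + 1 * (M zero (suc zero) * d)) (det-cong minor₀))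
         (cong₂ _+_ (cong (λ d → - + 1 * (M zero zero * d)) (det-cong minor₁)) (rest-swapped n M)) ⟩
      + 1 * (M zero (suc zero) * d₁) + (- + 1 * (M zero zero * d₀) + - rest n M)
    ≡⟨ solve 5 (λ a b c e t → con (+ 1) :* (a :* b) :+ (con (- + 1) :* (c :* e) :+ (:- t))
                            := :- (con (+ 1) :* (c :* e) :+ (con (- + 1) :* (a :* b) :+ t)))
         refl (M zero (suc zero)) d₁ (M zero zero) d₀ (rest n M) ⟩
      - det M
    ∎
    where
    M′ : Matrix (suc (suc n))
    M′ i j = M i (swap01 j)
    d₀ = det (minor M zero)
    d₁ = det (minor M (suc zero))
    minor₀ : ∀ i k → minor M′ zero i k ≡ minor M (suc zero) i k
    minor₀ i zero    = refl
    minor₀ i (suc k) = refl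
    minor₁ : ∀ i k → minor M′ (suc zero) i k ≡ minor M zero i k
    minor₁ i zero    = refl
    minor₁ i (suc k) = refl
    rest : ∀ n → Matrix (suc (suc n)) → ℤ
    rest n M = sumFin (λ j → sign (toℕ (suc (suc j))) * (M zero (suc (suc j)) * det (minor M (suc (suc j)))))
    rest-swapped : ∀ n (M : Matrix (suc (suc n))) → rest n (λ i j → M i (swap01 j)) ≡ - rest n M
    rest-swapped zero    M = refl
    rest-swapped (suc n) M = trans (sumFin-cong λ j → trans
        (cong (λ d → sign (toℕ j) * (M zero (suc (suc j)) * d))
          (trans (det-cong {N = λ i k → minor M (suc (suc j)) i (swap01 k)} (minor₂₊ j))
                 (det-swapColumns01 n (minor M (suc (suc j))))))
        (solve 3 (λ s a d → s :* (a :* (:- d)) := :- (s :* (a :* d))) refl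
          (sign (toℕ j)) (M zero (suc (suc j))) (det (minor M (suc (suc j))))))
      (sym (neg-distrib-sumFin (λ j → sign (toℕ j) * (M zero (suc (suc j)) * det (minor M (suc (suc j)))))))
      where
      minor₂₊ : ∀ j i k → minor (λ i j → M i (swap01 j)) (suc (suc j)) i k ≡ minor M (suc (suc j)) i (swap01 k)
      minor₂₊ j i zero          = refl
      minor₂₊ j i (suc zero)    = refl
      minor₂₊ j i (suc (suc k)) = refl

  det-swapRows01 : ∀ n (M : Matrix (suc (suc n))) → det (λ i j → M (swap01 i) j) ≡ - det M
  det-swapRows01 n M = begin
    det (λ i j → M (swap01 i) j)  ≡⟨ det-transpose _ (λ i j → M (swap01 i) j) ⟨
    det (λ i j → M (swap01 j) i)  ≡⟨ det-swapColumns01 n (M ᵀ) ⟩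
    - det (M ᵀ)                   ≡⟨ cong -_ (det-transpose _ M) ⟩
    - det M                       ∎

  det-liftRows : ∀ {n} (γ : Fin n → Fin n) (s : ℤ) → (∀ (M : Matrix n) → det (λ i j → M (γ i) j) ≡ s * det M) →
    ∀ (M : Matrix (suc n)) → det (λ i j → M (lift 1 γ i) j) ≡ s * det M
  det-liftRows γ s hyp M = trans (sumFin-cong λ j → trans
      (cong (λ d → sign (toℕ j) * (M zero j * d)) (hyp (minor M j)))
      (solve 4 (λ a b c d → a :* (b :* (c :* d)) := c :* (a :* (b :* d))) refl (sign (toℕ j)) (M zero j) s (det (minor M j))))
    (sym (*-distribˡ-sumFin s (λ j → sign (toℕ j) * (M zero j * det (minor M j)))))

  moveToFront : ∀ {n} → Fin (suc n) → Fin (suc n) → Fin (suc n)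
  moveToFront r zero    = r
  moveToFront r (suc i) = punchIn r i

  det-moveToFront : ∀ {n} (r : Fin (suc n)) (M : Matrix (suc n)) →
    det (λ i j → M (moveToFront r i) j) ≡ sign (toℕ r) * det M
  det-moveToFront zero M = trans (det-cong unmoved) (sym (ℤₚ.*-identityˡ (det M)))
    where
    unmoved : ∀ i j → M (moveToFront zero i) j ≡ M i j
    unmoved zero    j = refl
    unmoved (suc i) j = refl
  det-moveToFront {suc n} (suc r) M = begin
      det (λ i j → M (moveToFront (suc r) i) j)
    ≡⟨ det-cong rows ⟩
      det (λ i j → N (swap01 i) j)
    ≡⟨ det-swapRows01 n N ⟩
      - det N
    ≡⟨ cong -_ (det-liftRows (moveToFront r) (sign (toℕ r)) (det-moveToFront r) M) ⟩
      - (sign (toℕ r) * det M)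
    ≡⟨ ℤₚ.neg-distribˡ-* (sign (toℕ r)) (det M) ⟩
      - sign (toℕ r) * det M
    ≡⟨ cong (_* det M) (sign-suc (toℕ r)) ⟨
      sign (toℕ (suc r)) * det M
    ∎
    where
    N : Matrix (suc (suc n))
    N i j = M (lift 1 (moveToFront r) i) j
    rows : ∀ i j → M (moveToFront (suc r) i) j ≡ N (swap01 i) j
    rows zero          j = refl
    rows (suc zero)    j = refl
    rows (suc (suc i)) j = refl

  det-permuteRows : ∀ n (α : Fin n → Fin n) → Injective _≡_ _≡_ α →
    Σ ℤ λ s → s * s ≡ + 1 × ∀ M → det (λ i j → M (α i) j) ≡ s * det M
  det-permuteRows zero    α α-inj = + 1 , refl , λ M → refl
  det-permuteRows (suc n) α α-inj = s * sign (toℕ (α zero)) , sq , permute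
    where
    α₀≢ : ∀ i → α zero ≢ α (suc i)
    α₀≢ i eq with () ← α-inj eq
    α′ : Fin n → Fin n
    α′ i = punchOut (α₀≢ i)
    α′-inj : Injective _≡_ _≡_ α′
    α′-inj eq = Finₚ.suc-injective (α-inj (Finₚ.punchOut-injective (α₀≢ _) (α₀≢ _) eq))
    s = proj₁ (det-permuteRows n α′ α′-inj)
    sq : (s * sign (toℕ (α zero))) * (s * sign (toℕ (α zero))) ≡ + 1
    sq = trans (solve 2 (λ a b → (a :* b) :* (a :* b) := (a :* a) :* (b :* b)) refl s (sign (toℕ (α zero))))
      (cong₂ _*_ (proj₁ (proj₂ (det-permuteRows n α′ α′-inj))) (sign-sq (toℕ (α zero))))
    α-factor : ∀ i → α i ≡ moveToFront (α zero) (lift 1 α′ i)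
    α-factor zero    = refl
    α-factor (suc i) = sym (Finₚ.punchIn-punchOut (α₀≢ i))
    permute : ∀ M → det (λ i j → M (α i) j) ≡ (s * sign (toℕ (α zero))) * det M
    permute M = begin
        det (λ i j → M (α i) j)
      ≡⟨ det-cong (λ i j → cong (λ r → M r j) (α-factor i)) ⟩
        det (λ i j → M (moveToFront (α zero) (lift 1 α′ i)) j)
      ≡⟨ det-liftRows α′ s (proj₂ (proj₂ (det-permuteRows n α′ α′-inj))) (λ i j → M (moveToFront (α zero) i) j) ⟩
        s * det (λ i j → M (moveToFront (α zero) i) j)
      ≡⟨ cong (s *_) (det-moveToFront (α zero) M) ⟩
        s * (sign (toℕ (α zero)) * det M)
      ≡⟨ ℤₚ.*-assoc s _ _ ⟨
        (s * sign (toℕ (α zero))) * det M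
      ∎

  det-permute : ∀ n (α : Fin n → Fin n) → Injective _≡_ _≡_ α → ∀ (M : Matrix n) →
    det (λ i j → M (α i) (α j)) ≡ det M
  det-permute n α α-inj M with det-permuteRows n α α-inj
  ... | s , s² , rows = begin
    det (λ i j → M (α i) (α j))  ≡⟨ rows (λ i j → M i (α j)) ⟩
    s * det (λ i j → M i (α j))  ≡⟨ cong (s *_) columns ⟩
    s * (s * det M)              ≡⟨ ℤₚ.*-assoc s s (det M) ⟨
    (s * s) * det M              ≡⟨ cong (_* det M) s² ⟩
    + 1 * det M                  ≡⟨ ℤₚ.*-identityˡ (det M) ⟩
    det M                        ∎
    where
    columns : det (λ i j → M i (α j)) ≡ s * det M
    columns = trans (sym (det-transpose n (λ i j → M i (α j))))
      (trans (rows (M ᵀ)) (cong (s *_) (det-transpose n M)))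

  det-blockLowerTriangular : ∀ a b (M : Matrix (a ℕ.+ b)) → (∀ i j → M (i ↑ˡ b) (a ↑ʳ j) ≡ + 0) →
    det M ≡ det (λ i j → M (i ↑ˡ b) (j ↑ˡ b)) * det (λ i j → M (a ↑ʳ i) (a ↑ʳ j))
  det-blockLowerTriangular zero    b M vanish = sym (ℤₚ.*-identityˡ (det M))
  det-blockLowerTriangular (suc a) b M vanish = begin
      det M
    ≡⟨ sumFin-++ (suc a) b term ⟩
      sumFin (λ i → term (i ↑ˡ b)) + sumFin (λ j → term (suc a ↑ʳ j))
    ≡⟨ cong₂ _+_ (sumFin-cong left) (trans (sumFin-cong right) (sumFin-zero {b})) ⟩
      sumFin (λ i → sign (toℕ i) * (A zero i * det (minor A i)) * det B) + + 0
    ≡⟨ ℤₚ.+-identityʳ _ ⟩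
      sumFin (λ i → sign (toℕ i) * (A zero i * det (minor A i)) * det B)
    ≡⟨ *-distribʳ-sumFin (det B) (λ i → sign (toℕ i) * (A zero i * det (minor A i))) ⟨
      det A * det B
    ∎
    where
    term : Fin (suc a ℕ.+ b) → ℤ
    term j = sign (toℕ j) * (M zero j * det (minor M j))
    A : Matrix (suc a)
    A i j = M (i ↑ˡ b) (j ↑ˡ b)
    B : Matrix b
    B i j = M (suc a ↑ʳ i) (suc a ↑ʳ j)
    punchIn-↑ˡ : ∀ {a} (i : Fin (suc a)) (c : Fin a) → punchIn (i ↑ˡ b) (c ↑ˡ b) ≡ punchIn i c ↑ˡ b
    punchIn-↑ˡ zero    c       = refl
    punchIn-↑ˡ (suc i) zero    = refl
    punchIn-↑ˡ (suc i) (suc c) = cong suc (punchIn-↑ˡ i c)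
    punchIn-↑ʳ : ∀ {a} (i : Fin (suc a)) (c : Fin b) → punchIn (i ↑ˡ b) (a ↑ʳ c) ≡ suc a ↑ʳ c
    punchIn-↑ʳ         zero    c = refl
    punchIn-↑ʳ {suc a} (suc i) c = cong suc (punchIn-↑ʳ i c)
    right : ∀ j → term (suc a ↑ʳ j) ≡ + 0
    right j = trans (cong (λ x → sign (toℕ (suc a ↑ʳ j)) * (x * det (minor M (suc a ↑ʳ j)))) (vanish zero j))
      (trans (cong (sign (toℕ (suc a ↑ʳ j)) *_) (ℤₚ.*-zeroˡ (det (minor M (suc a ↑ʳ j)))))
             (ℤₚ.*-zeroʳ (sign (toℕ (suc a ↑ʳ j)))))
    left : ∀ i → term (i ↑ˡ b) ≡ sign (toℕ i) * (A zero i * det (minor A i)) * det B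
    left i = begin
        sign (toℕ (i ↑ˡ b)) * (M zero (i ↑ˡ b) * det Mᵢ)
      ≡⟨ cong₂ (λ s d → s * (A zero i * d)) (cong sign (Finₚ.toℕ-↑ˡ i b))
           (det-blockLowerTriangular a b Mᵢ (λ r c → trans (cong (M (suc (r ↑ˡ b))) (punchIn-↑ʳ i c)) (vanish (suc r) c))) ⟩
        sign (toℕ i) * (A zero i * (det (λ r c → Mᵢ (r ↑ˡ b) (c ↑ˡ b)) * det (λ r c → Mᵢ (a ↑ʳ r) (a ↑ʳ c))))
      ≡⟨ cong₂ (λ d e → sign (toℕ i) * (A zero i * (d * e)))
           (det-cong (λ r c → cong (M (suc (r ↑ˡ b))) (punchIn-↑ˡ i c)))
           (det-cong (λ r c → cong (M (suc (a ↑ʳ r))) (punchIn-↑ʳ i c))) ⟩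
        sign (toℕ i) * (A zero i * (det (minor A i) * det B))
      ≡⟨ solve 4 (λ s t d e → s :* (t :* (d :* e)) := s :* (t :* d) :* e)
           refl (sign (toℕ i)) (A zero i) (det (minor A i)) (det B) ⟩
        sign (toℕ i) * (A zero i * det (minor A i)) * det B
      ∎
      where
      Mᵢ : Matrix (a ℕ.+ b)
      Mᵢ = minor M (i ↑ˡ b)

module Graphs where
  open Determinant
  open import Data.Nat as ℕ using (zero; suc)
  open import Data.Fin using (zero; suc; _↑ˡ_; _↑ʳ_; splitAt; combine; remQuot; quotient; remainder)
  open import Data.Fin.Properties as Finₚ using (_≟_; *↔×; remQuot-combine; combine-surjective)
  open import Data.Integer as ℤ using (+_; _*_)
  import Data.Integer.Properties as ℤₚ
  open import Data.Bool using (true; false; if_then_else_)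
  open import Data.Sum using (_⊎_; inj₁; inj₂)
  open import Data.Product using (Σ; proj₁; proj₂)
  open import Data.Product.Algebra using (×-assoc)
  open import Data.Product.Function.NonDependent.Propositional using (_×-↔_)
  open import Function using (Injective)
  open import Function.Bundles using (_↔_; Inverse; Injection)
  open import Function.Construct.Composition using (_↔-∘_)
  open import Function.Properties.Inverse using (↔-refl; ↔-sym; ↔⇒↣)
  open import Relation.Binary.Construct.Closure.ReflexiveTransitive using (Star)
  open import Relation.Binary.PropositionalEquality
  open import Relation.Nullary using (yes; no)
  open Inverse using (to; from; strictlyInverseˡ)

  Edge : ∀ {n} → Graph n → Fin n → Fin n → Set
  Edge Γ u v = Γ u v ≡ true

  Connected : ∀ {n} → Graph n → Set
  Connected {n} Γ = Σ (Fin n) λ r → ∀ v → Star (Edge Γ) r v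

  ≗⇒≅ : ∀ {n} {A B : Graph n} → (∀ i j → A i j ≡ B i j) → A ≅ B
  ≗⇒≅ A≗B = ↔-refl , λ i j → sym (A≗B i j)

  ≅-sym : ∀ {n m} {A : Graph n} {B : Graph m} → A ≅ B → B ≅ A
  ≅-sym {B = B} (σ , σ-edge) = ↔-sym σ , λ i j →
    trans (sym (σ-edge (from σ i) (from σ j))) (cong₂ B (strictlyInverseˡ σ i) (strictlyInverseˡ σ j))

  ≅-trans : ∀ {n m p} {A : Graph n} {B : Graph m} {C : Graph p} → A ≅ B → B ≅ C → A ≅ C
  ≅-trans (σ , σ-edge) (τ , τ-edge) = τ ↔-∘ σ , λ i j → trans (τ-edge _ _) (σ-edge i j)

  ≅-refl : ∀ {n} {A : Graph n} → A ≅ A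
  ≅-refl = ≗⇒≅ λ _ _ → refl

  module ≅-Reasoning where
    infix  1 begin_
    infixr 2 _≅⟨_⟩_ _≅⟨_⟨_
    infix  3 _∎

    -- _≅_ unfolds to a Σ-type from which Agda cannot recover the two graphs; wrapping it in a
    -- record lets them be inferred along a chain.
    record _IsRelatedTo_ {n m} (A : Graph n) (B : Graph m) : Set where
      constructor relTo
      field iso : A ≅ B

    begin_ : ∀ {n m} {A : Graph n} {B : Graph m} → A IsRelatedTo B → A ≅ B
    begin relTo A≅B = A≅B

    _≅⟨_⟩_ : ∀ {n m p} (A : Graph n) {B : Graph m} {C : Graph p} → A ≅ B → B IsRelatedTo C → A IsRelatedTo C
    _≅⟨_⟩_ A {B} {C} A≅B (relTo B≅C) = relTo (≅-trans {A = A} {B} {C} A≅B B≅C)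

    _≅⟨_⟨_ : ∀ {n m p} (A : Graph n) {B : Graph m} {C : Graph p} → B ≅ A → B IsRelatedTo C → A IsRelatedTo C
    _≅⟨_⟨_ A {B} {C} B≅A (relTo B≅C) = relTo (≅-trans {A = A} {B} {C} (≅-sym {A = B} {A} B≅A) B≅C)

    _∎ : ∀ {n} (A : Graph n) → A IsRelatedTo A
    A ∎ = relTo (≅-refl {A = A})

  ≅⇒≡ : ∀ {n m} {A : Graph n} {B : Graph m} → A ≅ B → n ≡ m
  ≅⇒≡ (σ , _) = Finₚ.cantor-schröder-bernstein
    (Injection.injective (↔⇒↣ σ)) (Injection.injective (↔⇒↣ (↔-sym σ)))

  union : ∀ {a b} → Graph a → Graph b → Fin a ⊎ Fin b → Fin a ⊎ Fin b → Bool
  union X Y (inj₁ i) (inj₁ j) = X i j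
  union X Y (inj₂ i) (inj₂ j) = Y i j
  union X Y (inj₁ i) (inj₂ j) = false
  union X Y (inj₂ i) (inj₁ j) = false

  _⊕_ : ∀ {a b} → Graph a → Graph b → Graph (a ℕ.+ b)
  _⊕_ {a} X Y u v = union X Y (splitAt a u) (splitAt a v)

  module _ {a b} (X : Graph a) (Y : Graph b) where
    ⊕-↑ˡ : ∀ i j → (X ⊕ Y) (i ↑ˡ b) (j ↑ˡ b) ≡ X i j
    ⊕-↑ˡ i j rewrite Finₚ.splitAt-↑ˡ a i b | Finₚ.splitAt-↑ˡ a j b = refl

    ⊕-↑ʳ : ∀ i j → (X ⊕ Y) (a ↑ʳ i) (a ↑ʳ j) ≡ Y i j
    ⊕-↑ʳ i j rewrite Finₚ.splitAt-↑ʳ a b i | Finₚ.splitAt-↑ʳ a b j = refl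

    ⊕-↑ˡ↑ʳ : ∀ i j → (X ⊕ Y) (i ↑ˡ b) (a ↑ʳ j) ≡ false
    ⊕-↑ˡ↑ʳ i j rewrite Finₚ.splitAt-↑ˡ a i b | Finₚ.splitAt-↑ʳ a b j = refl

    ⊕-↑ʳ↑ˡ : ∀ i j → (X ⊕ Y) (a ↑ʳ i) (j ↑ˡ b) ≡ false
    ⊕-↑ʳ↑ˡ i j rewrite Finₚ.splitAt-↑ʳ a b i | Finₚ.splitAt-↑ˡ a j b = refl

  ⊕-simple : ∀ {a b} {X : Graph a} {Y : Graph b} → IsSimple X → IsSimple Y → IsSimple (X ⊕ Y)
  ⊕-simple {a} {b} {X} {Y} (X-sym , X-loopless) (Y-sym , Y-loopless) =
    (λ u v → symmetric (splitAt a u) (splitAt a v)) , (λ u → loopless (splitAt a u))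
    where
    symmetric : ∀ p q → union X Y p q ≡ union X Y q p
    symmetric (inj₁ i) (inj₁ j) = X-sym i j
    symmetric (inj₁ i) (inj₂ j) = refl
    symmetric (inj₂ i) (inj₁ j) = refl
    symmetric (inj₂ i) (inj₂ j) = Y-sym i j
    loopless : ∀ p → union X Y p p ≡ false
    loopless (inj₁ i) = X-loopless i
    loopless (inj₂ i) = Y-loopless i

  copies : ∀ {m} k → Graph m → Graph (k ℕ.* m)
  copies zero    X ()
  copies (suc k) X = X ⊕ copies k X

  copies-simple : ∀ {m} k {X : Graph m} → IsSimple X → IsSimple (copies k X)
  copies-simple zero    X-simple = (λ ()) , (λ ())
  copies-simple (suc k) X-simple = ⊕-simple X-simple (copies-simple k X-simple)

  copies-within : ∀ {m} k (X : Graph m) (c : Fin k) a b → copies k X (combine c a) (combine c b) ≡ X a b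
  copies-within (suc k) X zero    a b = ⊕-↑ˡ X (copies k X) a b
  copies-within (suc k) X (suc c) a b = trans (⊕-↑ʳ X (copies k X) _ _) (copies-within k X c a b)

  copies-across : ∀ {m} k (X : Graph m) {c c′ : Fin k} a b → c ≢ c′ → copies k X (combine c a) (combine c′ b) ≡ false
  copies-across (suc k) X {zero}  {zero}   a b c≢c′ with () ← c≢c′ refl
  copies-across (suc k) X {zero}  {suc c′} a b c≢c′ = ⊕-↑ˡ↑ʳ X (copies k X) a _
  copies-across (suc k) X {suc c} {zero}   a b c≢c′ = ⊕-↑ʳ↑ˡ X (copies k X) _ b
  copies-across (suc k) X {suc c} {suc c′} a b c≢c′ =
    trans (⊕-↑ʳ X (copies k X) _ _) (copies-across k X a b (λ c≡c′ → c≢c′ (cong suc c≡c′)))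

  quotient-combine : ∀ {k m} (c : Fin k) (a : Fin m) → quotient m (combine c a) ≡ c
  quotient-combine c a = cong proj₁ (remQuot-combine c a)

  remainder-combine : ∀ {k m} (c : Fin k) (a : Fin m) → remainder {k} m (combine c a) ≡ a
  remainder-combine c a = cong proj₂ (remQuot-combine c a)

  copies-edge⇒quotient≡ : ∀ {m} k (X : Graph m) {u v} → Edge (copies k X) u v → quotient {k} m u ≡ quotient m v
  copies-edge⇒quotient≡ {m} k X {u} {v} uv with combine-surjective {k} {m} u | combine-surjective {k} {m} v
  ... | c , a , refl | c′ , b , refl = trans (quotient-combine c a) (trans sameBlock (sym (quotient-combine c′ b)))
    where
    sameBlock : c ≡ c′
    sameBlock with c ≟ c′
    ... | yes c≡c′ = c≡c′
    ... | no  c≢c′ with () ← trans (sym (copies-across k X a b c≢c′)) uv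

  copies-≅ : ∀ {k m N} {X : Graph m} {Γ : Graph N} (ι : (Fin k × Fin m) ↔ Fin N) →
    (∀ c a b → Γ (to ι (c , a)) (to ι (c , b)) ≡ X a b) →
    (∀ {c c′} a b → c ≢ c′ → Γ (to ι (c , a)) (to ι (c′ , b)) ≡ false) →
    copies k X ≅ Γ
  copies-≅ {k} {m} {X = X} {Γ} ι within across = ι ↔-∘ *↔× , edge
    where
    edge : ∀ u v → Γ (to ι (remQuot m u)) (to ι (remQuot m v)) ≡ copies k X u v
    edge u v with combine-surjective {k} {m} u | combine-surjective {k} {m} v
    ... | c , a , refl | c′ , b , refl rewrite remQuot-combine c a | remQuot-combine c′ b with c ≟ c′
    ...   | yes refl = trans (within c a b) (sym (copies-within k X c a b))
    ...   | no  c≢c′ = trans (across a b c≢c′) (sym (copies-across k X a b c≢c′))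

  ≡⇒copies≅ : ∀ {m j j′} {X : Graph m} → j ≡ j′ → copies j X ≅ copies j′ X
  ≡⇒copies≅ refl = ≅-refl

  copies-cong : ∀ {m m′} k {X : Graph m} {Y : Graph m′} → X ≅ Y → copies k X ≅ copies k Y
  copies-cong {m} {m′} k {X} {Y} (σ , σ-edge) = copies-≅ {Γ = copies k Y} ι
    (λ c a b → trans (copies-within k Y c _ _) (σ-edge a b))
    (λ a b c≢c′ → copies-across k Y _ _ c≢c′)
    where
    ι : (Fin k × Fin m) ↔ Fin (k ℕ.* m′)
    ι = ↔-sym *↔× ↔-∘ (↔-refl ×-↔ σ)

  copies-flatten : ∀ {m} k j (X : Graph m) → copies (k ℕ.* j) X ≅ copies k (copies j X)
  copies-flatten {m} k j X = copies-≅ {Γ = copies k (copies j X)} ι within across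
    where
    ι : (Fin (k ℕ.* j) × Fin m) ↔ Fin (k ℕ.* (j ℕ.* m))
    ι = ↔-sym (*↔× {k}) ↔-∘ ((↔-refl ×-↔ ↔-sym (*↔× {j})) ↔-∘ (×-assoc 0ℓ _ _ _ ↔-∘ (*↔× ×-↔ ↔-refl)))
    within : ∀ u a b → copies k (copies j X) (to ι (u , a)) (to ι (u , b)) ≡ X a b
    within u a b with combine-surjective {k} {j} u
    ... | c , c′ , refl rewrite quotient-combine {k} {j} c c′ | remainder-combine {k} {j} c c′ =
      trans (copies-within k (copies j X) c _ _) (copies-within j X c′ a b)
    across : ∀ {u u′} a b → u ≢ u′ → copies k (copies j X) (to ι (u , a)) (to ι (u′ , b)) ≡ false
    across {u} {u′} a b u≢u′ with combine-surjective {k} {j} u | combine-surjective {k} {j} u′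
    ... | c , c′ , refl | d , d′ , refl
      rewrite quotient-combine {k} {j} c c′ | remainder-combine {k} {j} c c′
            | quotient-combine {k} {j} d d′ | remainder-combine {k} {j} d d′ with c ≟ d
    ...   | no  c≢d = copies-across k (copies j X) _ _ c≢d
    ...   | yes refl with c′ ≟ d′
    ...     | yes refl with () ← u≢u′ refl
    ...     | no  c′≢d′ = trans (copies-within k (copies j X) c _ _) (copies-across j X a b c′≢d′)

  δ-refl : ∀ {n} (i : Fin n) → δ i i ≡ + 1
  δ-refl zero    = refl
  δ-refl (suc i) = δ-refl i

  δ-≢ : ∀ {n} {i j : Fin n} → i ≢ j → δ i j ≡ + 0
  δ-≢ {i = zero}  {zero}  i≢j with () ← i≢j refl
  δ-≢ {i = zero}  {suc j} i≢j = refl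
  δ-≢ {i = suc i} {zero}  i≢j = refl
  δ-≢ {i = suc i} {suc j} i≢j = δ-≢ (λ i≡j → i≢j (cong suc i≡j))

  δ-injective : ∀ {n m} (α : Fin n → Fin m) → Injective _≡_ _≡_ α → ∀ i j → δ (α i) (α j) ≡ δ i j
  δ-injective α α-inj i j with i ≟ j
  ... | yes refl = trans (δ-refl (α i)) (sym (δ-refl i))
  ... | no  i≢j  = trans (δ-≢ (λ αi≡αj → i≢j (α-inj αi≡αj))) (sym (δ-≢ i≢j))

  charPoly-cong : ∀ {n} {A B : Graph n} → (∀ i j → A i j ≡ B i j) → ∀ x → charPoly A x ≡ charPoly B x
  charPoly-cong A≗B x = det-cong (λ i j → cong (λ e → (x * δ i j) ℤ.- (if e then + 1 else + 0)) (A≗B i j))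

  charPoly-relabel : ∀ {n} (A : Graph n) (α : Fin n → Fin n) → Injective _≡_ _≡_ α →
    ∀ x → charPoly (λ i j → A (α i) (α j)) x ≡ charPoly A x
  charPoly-relabel {n} A α α-inj x = trans
    (det-cong (λ i j → cong (λ d → (x * d) ℤ.- adjMatrix A (α i) (α j)) (sym (δ-injective α α-inj i j))))
    (det-permute n α α-inj (λ i j → (x * δ i j) ℤ.- adjMatrix A i j))

  ↑ˡ≢↑ʳ : ∀ {a b} (i : Fin a) (j : Fin b) → i ↑ˡ b ≢ a ↑ʳ j
  ↑ˡ≢↑ʳ {a} {b} i j eq
    with () ← trans (sym (Finₚ.splitAt-↑ˡ a i b)) (trans (cong (splitAt a) eq) (Finₚ.splitAt-↑ʳ a b j))

  charPoly-⊕ : ∀ {a b} (X : Graph a) (Y : Graph b) x → charPoly (X ⊕ Y) x ≡ charPoly X x * charPoly Y x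
  charPoly-⊕ {a} {b} X Y x = trans (det-blockLowerTriangular a b _ vanish) (cong₂ _*_ upperLeft lowerRight)
    where
    vanish : ∀ i j → (x * δ (i ↑ˡ b) (a ↑ʳ j)) ℤ.- adjMatrix (X ⊕ Y) (i ↑ˡ b) (a ↑ʳ j) ≡ + 0
    vanish i j rewrite δ-≢ (↑ˡ≢↑ʳ i j) | ⊕-↑ˡ↑ʳ X Y i j | ℤₚ.*-zeroʳ x = refl
    upperLeft : det (λ i j → (x * δ (i ↑ˡ b) (j ↑ˡ b)) ℤ.- adjMatrix (X ⊕ Y) (i ↑ˡ b) (j ↑ˡ b)) ≡ charPoly X x
    upperLeft = det-cong λ i j → cong₂ (λ d e → (x * d) ℤ.- (if e then + 1 else + 0))
      (δ-injective (_↑ˡ b) (λ {i} {j} → Finₚ.↑ˡ-injective b i j) i j) (⊕-↑ˡ X Y i j)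
    lowerRight : det (λ i j → (x * δ (a ↑ʳ i) (a ↑ʳ j)) ℤ.- adjMatrix (X ⊕ Y) (a ↑ʳ i) (a ↑ʳ j)) ≡ charPoly Y x
    lowerRight = det-cong λ i j → cong₂ (λ d e → (x * d) ℤ.- (if e then + 1 else + 0))
      (δ-injective (a ↑ʳ_) (λ {i} {j} → Finₚ.↑ʳ-injective a i j) i j) (⊕-↑ʳ X Y i j)

  ≅⇒Cospectral : ∀ {n m} {A : Graph n} {B : Graph m} → A ≅ B → Cospectral A B
  ≅⇒Cospectral {A = A} {B} iso@(σ , σ-edge) with ≅⇒≡ {A = A} {B} iso
  ... | refl = refl , λ x → trans (sym (charPoly-cong {A = λ i j → B (to σ i) (to σ j)} σ-edge x))
                                  (charPoly-relabel B (to σ) (Injection.injective (↔⇒↣ σ)) x)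

  Cospectral-refl : ∀ {n} {A : Graph n} → Cospectral A A
  Cospectral-refl = refl , λ _ → refl

  Cospectral-sym : ∀ {n m} {A : Graph n} {B : Graph m} → Cospectral A B → Cospectral B A
  Cospectral-sym (n≡m , χ≡) = sym n≡m , λ x → sym (χ≡ x)

  Cospectral-trans : ∀ {n m p} {A : Graph n} {B : Graph m} {C : Graph p} →
    Cospectral A B → Cospectral B C → Cospectral A C
  Cospectral-trans (n≡m , χ≡) (m≡p , χ≡′) = trans n≡m m≡p , λ x → trans (χ≡ x) (χ≡′ x)

  Cospectral-⊕ : ∀ {a a′ b b′} {X : Graph a} {X′ : Graph a′} {Y : Graph b} {Y′ : Graph b′} →
    Cospectral X X′ → Cospectral Y Y′ → Cospectral (X ⊕ Y) (X′ ⊕ Y′)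
  Cospectral-⊕ {X = X} {X′} {Y} {Y′} (a≡a′ , χX≡) (b≡b′ , χY≡) = cong₂ ℕ._+_ a≡a′ b≡b′ , λ x → begin
    charPoly (X ⊕ Y) x          ≡⟨ charPoly-⊕ X Y x ⟩
    charPoly X x * charPoly Y x   ≡⟨ cong₂ _*_ (χX≡ x) (χY≡ x) ⟩
    charPoly X′ x * charPoly Y′ x ≡⟨ charPoly-⊕ X′ Y′ x ⟨
    charPoly (X′ ⊕ Y′) x        ∎
    where open ≡-Reasoning

  Cospectral-copies : ∀ {m m′} k {X : Graph m} {X′ : Graph m′} → Cospectral X X′ → Cospectral (copies k X) (copies k X′)
  Cospectral-copies zero    X~X′ = refl , λ _ → refl
  Cospectral-copies (suc k) X~X′ = Cospectral-⊕ X~X′ (Cospectral-copies k X~X′)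

module FirstReturn where
  open Graphs
  open import Data.Nat as ℕ using (zero; suc; _≤_; _<_; z≤n; s≤s)
  import Data.Nat.Properties as ℕₚ
  open import Data.Fin using (toℕ; _↑ˡ_; splitAt)
  import Data.Fin.Properties as Finₚ
  open import Data.Bool using (true; false; if_then_else_)
  import Data.Bool.Properties as Boolₚ
  open import Data.Sum using (inj₁; inj₂; [_,_]′; fromInj₁)
  open import Data.Product using (Σ; ∃; proj₁; proj₂)
  open import Function using (const)
  open import Function.Bundles using (_↔_; Inverse; mk⇔; mk↔ₛ′)
  open import Function.Properties.Inverse using (↔-sym)
  open import Relation.Binary.PropositionalEquality
  open Inverse using (to; from; strictlyInverseʳ)

  iterate : ∀ {A : Set} → (A → A) → ℕ → A → A
  iterate f zero    x = x
  iterate f (suc t) x = iterate f t (f x)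

  iterate-+ : ∀ {A : Set} (f : A → A) p q x → iterate f (p ℕ.+ q) x ≡ iterate f q (iterate f p x)
  iterate-+ f zero    q x = refl
  iterate-+ f (suc p) q x = iterate-+ f p q (f x)

  periodic : ∀ {N} (σ : Fin N ↔ Fin N) u → ∃ λ t → t < N × iterate (to σ) (suc t) u ≡ u
  periodic {N} σ u with Finₚ.pigeonhole (ℕₚ.n<1+n N) (λ (i : Fin (suc N)) → iterate (to σ) (toℕ i) u)
  ... | i , j , i<j , fⁱu≡fʲu = ℕ.pred d , pred-d<N , sym (iterate-injective (toℕ i) period)
    where
    d = toℕ j ℕ.∸ toℕ i
    suc-pred-d : suc (ℕ.pred d) ≡ d
    suc-pred-d = ℕₚ.suc-pred d {{ℕ.>-nonZero (ℕₚ.m<n⇒0<n∸m i<j)}}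
    pred-d<N : ℕ.pred d < N
    pred-d<N = ℕₚ.<-≤-trans (ℕₚ.≤-reflexive suc-pred-d)
      (ℕₚ.≤-trans (ℕₚ.m∸n≤m (toℕ j) (toℕ i)) (ℕ.s≤s⁻¹ (Finₚ.toℕ<n j)))
    iterate-injective : ∀ p {x y} → iterate (to σ) p x ≡ iterate (to σ) p y → x ≡ y
    iterate-injective zero    eq = eq
    iterate-injective (suc p) {x} {y} eq = trans (sym (strictlyInverseʳ σ x))
      (trans (cong (from σ) (iterate-injective p eq)) (strictlyInverseʳ σ y))
    period : iterate (to σ) (toℕ i) u ≡ iterate (to σ) (toℕ i) (iterate (to σ) (suc (ℕ.pred d)) u)
    period = begin
      iterate (to σ) (toℕ i) u
        ≡⟨ fⁱu≡fʲu ⟩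
      iterate (to σ) (toℕ j) u
        ≡⟨ cong (λ t → iterate (to σ) t u) (ℕₚ.m∸n+n≡m (ℕₚ.<⇒≤ i<j)) ⟨
      iterate (to σ) (d ℕ.+ toℕ i) u
        ≡⟨ iterate-+ (to σ) d (toℕ i) u ⟩
      iterate (to σ) (toℕ i) (iterate (to σ) d u)
        ≡⟨ cong (λ t → iterate (to σ) (toℕ i) (iterate (to σ) t u)) suc-pred-d ⟨
      iterate (to σ) (toℕ i) (iterate (to σ) (suc (ℕ.pred d)) u)
        ∎
      where open ≡-Reasoning

  -- firstReturn k y is the first of f y, f² y, … to lie in L, but only the first k + 1 are
  -- searched: if none of them lies in L the result is meaningless.
  module Return {N} (f : Fin N → Fin N) (inL : Fin N → Bool) where
    firstReturn : ℕ → Fin N → Fin N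
    firstReturn zero    y = f y
    firstReturn (suc k) y = if inL (f y) then f y else firstReturn k (f y)

    data Excursion : Fin N → Fin N → ℕ → Set where
      leave : ∀ {y} → Excursion y (f y) 0
      stay  : ∀ {y z n} → inL (f y) ≡ false → Excursion (f y) z n → Excursion y z (suc n)

    excursion⇒firstReturn : ∀ {y z n} → Excursion y z n → inL z ≡ true → ∀ {k} → n ≤ k → firstReturn k y ≡ z
    excursion⇒firstReturn leave z∈L {zero}  _ = refl
    excursion⇒firstReturn leave z∈L {suc k} _ rewrite z∈L = refl
    excursion⇒firstReturn (stay fy∉L e) z∈L {suc k} (s≤s n≤k) rewrite fy∉L = excursion⇒firstReturn e z∈L n≤k

    excursion-extend : ∀ {y w n} → Excursion y w n → inL w ≡ false → Excursion y (f w) (suc n)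
    excursion-extend leave          w∉L = stay w∉L leave
    excursion-extend (stay fy∉L e)  w∉L = stay fy∉L (excursion-extend e w∉L)

    excursion-to-L : ∀ t y → inL (iterate f (suc t) y) ≡ true →
      Σ ℕ λ n → Σ (Fin N) λ z → n ≤ t × inL z ≡ true × Excursion y z n
    excursion-to-L t y hit with inL (f y) in fy∈L?
    ... | true  = 0 , f y , z≤n , fy∈L? , leave
    excursion-to-L zero    y hit | false with () ← trans (sym fy∈L?) hit
    excursion-to-L (suc t) y hit | false with excursion-to-L t (f y) hit
    ... | n , z , n≤t , z∈L , e = suc n , z , s≤s n≤t , z∈L , stay fy∈L? e

  module _ {N} (σ : Fin N ↔ Fin N) (inL : Fin N → Bool) where
    private
      module F = Return (to σ) inL
      module G = Return (from σ) inL

    excursion-reverse : ∀ {y z n} → F.Excursion y z n → G.Excursion z y n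
    excursion-reverse {y} F.leave = subst (λ w → G.Excursion (to σ y) w 0) (strictlyInverseʳ σ y) G.leave
    excursion-reverse {y} (F.stay fy∉L e) =
      subst (λ w → G.Excursion _ w _) (strictlyInverseʳ σ y) (G.excursion-extend (excursion-reverse e) fy∉L)

    firstReturn-inverse : ∀ {y} → inL y ≡ true →
      inL (F.firstReturn N y) ≡ true × G.firstReturn N (F.firstReturn N y) ≡ y
    firstReturn-inverse {y} y∈L with periodic σ y
    ... | t , t<N , fᵗ⁺¹y≡y with F.excursion-to-L t y (trans (cong inL fᵗ⁺¹y≡y) y∈L)
    ... | n , z , n≤t , z∈L , e = subst (λ w → inL w ≡ true × G.firstReturn N w ≡ y)
      (sym (F.excursion⇒firstReturn e z∈L n≤N)) (z∈L , G.excursion⇒firstReturn (excursion-reverse e) y∈L n≤N)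
      where
      n≤N : n ≤ N
      n≤N = ℕₚ.≤-trans n≤t (ℕₚ.<⇒≤ t<N)

  module _ {N} (f : Fin N → Fin N) (inL : Fin N → Bool) {Γ Δ : Graph N}
    (f-edge : ∀ u v → Δ (f u) (f v) ≡ Γ u v)
    (separated : ∀ {u v} → Edge Δ u v → inL u ≡ inL v)
    (agree : ∀ {u v} → inL u ≡ false → inL v ≡ false → Γ u v ≡ Δ u v) where
    open Return f inL

    firstReturn-edge : ∀ k {y y′} → Edge Γ y y′ → Edge Δ (firstReturn k y) (firstReturn k y′)
    firstReturn-edge zero {y} {y′} yy′ = trans (f-edge y y′) yy′
    firstReturn-edge (suc k) {y} {y′} yy′ with inL (f y) in fy∈L? | inL (f y′) in fy′∈L?
    ... | true  | true  = trans (f-edge y y′) yy′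
    ... | false | false = firstReturn-edge k (trans (agree fy∈L? fy′∈L?) (trans (f-edge y y′) yy′))
    ... | true  | false with () ← trans (sym fy∈L?) (trans (separated (trans (f-edge y y′) yy′)) fy′∈L?)
    ... | false | true  with () ← trans (sym fy∈L?) (trans (separated (trans (f-edge y y′) yy′)) fy′∈L?)

  ⊕-cancelʳ : ∀ {a b} {X Y : Graph a} {R : Graph b} → (X ⊕ R) ≅ (Y ⊕ R) → X ≅ Y
  ⊕-cancelʳ {a} {b} {X} {Y} {R} (σ , σ-edge) = mk↔ₛ′ T T′ T∘T′ T′∘T , T-edge
    where
    N = a ℕ.+ b

    inL : Fin N → Bool
    inL u = [ const true , const false ]′ (splitAt a u)

    ↑ˡ∈L : ∀ x → inL (x ↑ˡ b) ≡ true
    ↑ˡ∈L x rewrite Finₚ.splitAt-↑ˡ a x b = refl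

    left : Fin a → Fin N → Fin a
    left d u = fromInj₁ (const d) (splitAt a u)

    left-↑ˡ : ∀ d x → left d (x ↑ˡ b) ≡ x
    left-↑ˡ d x rewrite Finₚ.splitAt-↑ˡ a x b = refl

    ↑ˡ-left : ∀ d u → inL u ≡ true → left d u ↑ˡ b ≡ u
    ↑ˡ-left d u u∈L with splitAt a u in eq
    ... | inj₁ x = Finₚ.splitAt⁻¹-↑ˡ eq

    separated : ∀ {Z : Graph a} {u v} → Edge (Z ⊕ R) u v → inL u ≡ inL v
    separated {u = u} {v} uv with splitAt a u | splitAt a v
    ... | inj₁ _ | inj₁ _ = refl
    ... | inj₂ _ | inj₂ _ = refl
    ... | inj₁ _ | inj₂ _ with () ← uv
    ... | inj₂ _ | inj₁ _ with () ← uv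

    agree : ∀ {Z Z′ : Graph a} {u v} → inL u ≡ false → inL v ≡ false → (Z ⊕ R) u v ≡ (Z′ ⊕ R) u v
    agree {u = u} {v} u∉L v∉L with splitAt a u | splitAt a v
    ... | inj₂ _ | inj₂ _ = refl
    ... | inj₁ _ | _      with () ← u∉L
    ... | inj₂ _ | inj₁ _ with () ← v∉L

    module F = Return (to σ) inL
    module G = Return (from σ) inL

    T T′ : Fin a → Fin a
    T  x = left x (F.firstReturn N (x ↑ˡ b))
    T′ x = left x (G.firstReturn N (x ↑ˡ b))

    T-↑ˡ : ∀ x → T x ↑ˡ b ≡ F.firstReturn N (x ↑ˡ b)
    T-↑ˡ x = ↑ˡ-left x _ (proj₁ (firstReturn-inverse σ inL (↑ˡ∈L x)))

    T′-↑ˡ : ∀ x → T′ x ↑ˡ b ≡ G.firstReturn N (x ↑ˡ b)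
    T′-↑ˡ x = ↑ˡ-left x _ (proj₁ (firstReturn-inverse (↔-sym σ) inL (↑ˡ∈L x)))

    G∘T : ∀ x → G.firstReturn N (T x ↑ˡ b) ≡ x ↑ˡ b
    G∘T x = trans (cong (G.firstReturn N) (T-↑ˡ x)) (proj₂ (firstReturn-inverse σ inL (↑ˡ∈L x)))

    F∘T′ : ∀ x → F.firstReturn N (T′ x ↑ˡ b) ≡ x ↑ˡ b
    F∘T′ x = trans (cong (F.firstReturn N) (T′-↑ˡ x)) (proj₂ (firstReturn-inverse (↔-sym σ) inL (↑ˡ∈L x)))

    T′∘T : ∀ x → T′ (T x) ≡ x
    T′∘T x = trans (cong (left (T x)) (G∘T x)) (left-↑ˡ (T x) x)

    T∘T′ : ∀ x → T (T′ x) ≡ x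
    T∘T′ x = trans (cong (left (T′ x)) (F∘T′ x)) (left-↑ˡ (T′ x) x)

    σ⁻¹-edge : ∀ u v → (X ⊕ R) (from σ u) (from σ v) ≡ (Y ⊕ R) u v
    σ⁻¹-edge = proj₂ (≅-sym {A = X ⊕ R} {B = Y ⊕ R} (σ , σ-edge))

    T-edge : ∀ i j → Y (T i) (T j) ≡ X i j
    T-edge i j = Boolₚ.⇔→≡ (mk⇔ reflect preserve)
      where
      preserve : X i j ≡ true → Y (T i) (T j) ≡ true
      preserve Xij = trans (trans (sym (⊕-↑ˡ Y R (T i) (T j))) (cong₂ (Y ⊕ R) (T-↑ˡ i) (T-↑ˡ j)))
        (firstReturn-edge (to σ) inL σ-edge separated agree N (trans (⊕-↑ˡ X R i j) Xij))
      reflect : Y (T i) (T j) ≡ true → X i j ≡ true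
      reflect YTij = trans (sym (⊕-↑ˡ X R i j)) (subst₂ (Edge (X ⊕ R)) (G∘T i) (G∘T j)
        (firstReturn-edge (from σ) inL σ⁻¹-edge separated agree N (trans (⊕-↑ˡ Y R (T i) (T j)) YTij)))

module FiniteGroups where
  open import Algebra.Bundles using (Group)
  open import Algebra.Core using (Op₁; Op₂)
  import Algebra.Definitions as Definitions
  open import Algebra.Structures using (IsGroup)
  import Algebra.Properties.Group as GroupProperties
  open import Function using (_∘_)
  open import Relation.Binary.PropositionalEquality
  open ≡-Reasoning

  finGroup : ∀ n (_∙_ : Op₂ (Fin n)) (ε : Fin n) (_⁻¹ : Op₁ (Fin n)) →
    Definitions.Associative _≡_ _∙_ → Definitions.Identity _≡_ ε _∙_ → Definitions.Inverse _≡_ ε _⁻¹ _∙_ → FinGroup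
  finGroup n _∙_ ε _⁻¹ assoc identity inverse = record
    { order = n ; _∙_ = _∙_ ; ε = ε ; _⁻¹ = _⁻¹
    ; isGroup = record
      { isMonoid = record
        { isSemigroup = record { isMagma = record { isEquivalence = isEquivalence ; ∙-cong = cong₂ _∙_ } ; assoc = assoc }
        ; identity = identity }
      ; inverse = inverse
      ; ⁻¹-cong = cong _⁻¹ } }

  module FinGroupProperties (G : FinGroup) where
    open FinGroup G public using (ε; isGroup) renaming (_∙_ to infixl 7 _∙_; _⁻¹ to infix 8 _⁻¹)
    open IsGroup isGroup public using (assoc; identityˡ; identityʳ; inverseˡ; inverseʳ)

    group : Group 0ℓ 0ℓ
    group = record { isGroup = isGroup }

    open GroupProperties group public
      using (⁻¹-involutive; ⁻¹-injective; ⁻¹-anti-homo-∙; ⁻¹-anti-homo-//; ε⁻¹≈ε; inverseˡ-unique; identityˡ-unique;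
             //-rightDividesˡ; //-rightDividesʳ; x∙y⁻¹≈ε⇒x≈y)

    //-translate : ∀ x y g → (x ∙ g) ∙ (y ∙ g) ⁻¹ ≡ x ∙ y ⁻¹
    //-translate x y g = begin
      (x ∙ g) ∙ (y ∙ g) ⁻¹      ≡⟨ cong ((x ∙ g) ∙_) (⁻¹-anti-homo-∙ y g) ⟩
      (x ∙ g) ∙ (g ⁻¹ ∙ y ⁻¹)   ≡⟨ assoc x g _ ⟩
      x ∙ (g ∙ (g ⁻¹ ∙ y ⁻¹))   ≡⟨ cong (x ∙_) (assoc g (g ⁻¹) (y ⁻¹)) ⟨
      x ∙ ((g ∙ g ⁻¹) ∙ y ⁻¹)   ≡⟨ cong (λ e → x ∙ (e ∙ y ⁻¹)) (inverseʳ g) ⟩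
      x ∙ (ε ∙ y ⁻¹)            ≡⟨ cong (x ∙_) (identityˡ (y ⁻¹)) ⟩
      x ∙ y ⁻¹                  ∎

    //-chain : ∀ x y z → (x ∙ y ⁻¹) ∙ (y ∙ z ⁻¹) ≡ x ∙ z ⁻¹
    //-chain x y z = begin
      (x ∙ y ⁻¹) ∙ (y ∙ z ⁻¹)   ≡⟨ assoc x (y ⁻¹) _ ⟩
      x ∙ (y ⁻¹ ∙ (y ∙ z ⁻¹))   ≡⟨ cong (x ∙_) (assoc (y ⁻¹) y (z ⁻¹)) ⟨
      x ∙ ((y ⁻¹ ∙ y) ∙ z ⁻¹)   ≡⟨ cong (λ e → x ∙ (e ∙ z ⁻¹)) (inverseˡ y) ⟩
      x ∙ (ε ∙ z ⁻¹)            ≡⟨ cong (x ∙_) (identityˡ (z ⁻¹)) ⟩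
      x ∙ z ⁻¹                  ∎

    Cay-translate : ∀ (S : Fin (order G) → Bool) u v g → Cay G S (u ∙ g) (v ∙ g) ≡ Cay G S u v
    Cay-translate S u v g = cong S (//-translate u v g)

    Cay-simple : ∀ {S} → IsConnectionSet G S → IsSimple (Cay G S)
    Cay-simple {S} (S-ε , S-⁻¹) =
      (λ u v → trans (sym (S-⁻¹ (u ∙ v ⁻¹))) (cong S (⁻¹-anti-homo-// u v))) ,
      (λ u → trans (cong S (inverseʳ u)) S-ε)

  module SubgroupEmbeddingProperties {H G : FinGroup} (ι : SubgroupEmbedding H G) where
    open SubgroupEmbedding ι
    open FinGroupProperties G
    private module H = FinGroupProperties H

    φ-ε : φ H.ε ≡ ε
    φ-ε = identityˡ-unique (φ H.ε) (φ H.ε) (begin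
      φ H.ε ∙ φ H.ε   ≡⟨ hom H.ε H.ε ⟨
      φ (H.ε H.∙ H.ε) ≡⟨ cong φ (H.identityˡ H.ε) ⟩
      φ H.ε           ∎)

    φ-⁻¹ : ∀ x → φ (x H.⁻¹) ≡ φ x ⁻¹
    φ-⁻¹ x = inverseˡ-unique (φ (x H.⁻¹)) (φ x)
      (trans (sym (hom (x H.⁻¹) x)) (trans (cong φ (H.inverseˡ x)) φ-ε))

    φ-// : ∀ x y → φ (x H.∙ y H.⁻¹) ≡ φ x ∙ φ y ⁻¹
    φ-// x y = trans (hom x (y H.⁻¹)) (cong (φ x ∙_) (φ-⁻¹ y))

    Cay-induced : ∀ (S : Fin (order G) → Bool) a b → Cay H (S ∘ φ) a b ≡ Cay G S (φ a) (φ b)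
    Cay-induced S a b = cong S (φ-// a b)

module FinSubsets where
  open import Data.Nat as ℕ using (zero; suc; _≤_; _<_; z≤n; s≤s)
  import Data.Nat.Properties as ℕₚ
  open import Data.Fin using (zero; suc)
  open import Data.Bool using (true; false; if_then_else_)
  open import Data.List using (List; filter; length; lookup; allFin)
  open import Data.List.Membership.Propositional.Properties using (∈-filter⁺; ∈-filter⁻; ∈-allFin; ∈-lookup)
  import Data.List.Relation.Unary.All as All
  open import Data.List.Relation.Unary.AllPairs using (_∷_)
  open import Data.List.Relation.Unary.Any using (index)
  open import Data.List.Relation.Unary.Any.Properties using (lookup-index)
  open import Data.List.Relation.Unary.Unique.Propositional using (Unique)
  import Data.List.Relation.Unary.Unique.Propositional.Properties as Uniqueₚ
  open import Data.Product using (∃; proj₂)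
  open import Function using (Injective; _∘_)
  open import Relation.Binary.PropositionalEquality
  open import Relation.Nullary using (yes; no; does; contradiction)

  lookup-injective : ∀ {A : Set} {xs : List A} → Unique xs → Injective _≡_ _≡_ (lookup xs)
  lookup-injective (x∉ ∷ xs!) {zero}  {zero}  eq = refl
  lookup-injective (x∉ ∷ xs!) {zero}  {suc j} eq with () ← All.lookup x∉ (∈-lookup j) eq
  lookup-injective (x∉ ∷ xs!) {suc i} {zero}  eq with () ← All.lookup x∉ (∈-lookup i) (sym eq)
  lookup-injective (x∉ ∷ xs!) {suc i} {suc j} eq = cong suc (lookup-injective xs! eq)

  record Enumeration {n} (P : Pred (Fin n) 0ℓ) : Set where
    field
      size      : ℕ
      elem      : Fin size → Fin n
      injective : Injective _≡_ _≡_ elem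
      sound     : ∀ a → P (elem a)
      complete  : ∀ {x} → P x → ∃ λ a → elem a ≡ x

  abstract
    enumerate : ∀ {n} {P : Pred (Fin n) 0ℓ} → Decidable P → Enumeration P
    enumerate {n} P? = record
      { size      = length (filter P? (allFin n))
      ; elem      = lookup (filter P? (allFin n))
      ; injective = lookup-injective (Uniqueₚ.filter⁺ P? (Uniqueₚ.allFin⁺ n))
      ; sound     = λ a → proj₂ (∈-filter⁻ P? {xs = allFin n} (∈-lookup a))
      ; complete  = λ Px → let x∈xs = ∈-filter⁺ P? (∈-allFin _) Px in index x∈xs , sym (lookup-index x∈xs)
      }

  count : ∀ {m} {P : Pred (Fin m) 0ℓ} → Decidable P → ℕ
  count {zero}  P? = 0
  count {suc m} P? = (if does (P? zero) then 1 else 0) ℕ.+ count (P? ∘ suc)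

  count-≤ : ∀ {m} {P : Pred (Fin m) 0ℓ} (P? : Decidable P) → count P? ≤ m
  count-≤ {zero}  P? = z≤n
  count-≤ {suc m} P? with does (P? zero)
  ... | true  = s≤s (count-≤ (P? ∘ suc))
  ... | false = ℕₚ.m≤n⇒m≤1+n (count-≤ (P? ∘ suc))

  count-mono : ∀ {m} {P Q : Pred (Fin m) 0ℓ} (P? : Decidable P) (Q? : Decidable Q) →
    (∀ {x} → P x → Q x) → count P? ≤ count Q?
  count-mono {zero}  P? Q? P⊆Q = z≤n
  count-mono {suc m} P? Q? P⊆Q with P? zero | Q? zero
  ... | yes _  | yes _  = s≤s (count-mono (P? ∘ suc) (Q? ∘ suc) P⊆Q)
  ... | no  _  | yes _  = ℕₚ.m≤n⇒m≤1+n (count-mono (P? ∘ suc) (Q? ∘ suc) P⊆Q)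
  ... | no  _  | no  _  = count-mono (P? ∘ suc) (Q? ∘ suc) P⊆Q
  ... | yes P0 | no ¬Q0 = contradiction (P⊆Q P0) ¬Q0

  count-< : ∀ {m} {P Q : Pred (Fin m) 0ℓ} (P? : Decidable P) (Q? : Decidable Q) →
    (∀ {x} → P x → Q x) → ∀ {x} → ¬ P x → Q x → count P? < count Q?
  count-< {suc m} P? Q? P⊆Q {zero} ¬P0 Q0 with P? zero | Q? zero
  ... | yes P0 | _      = contradiction P0 ¬P0
  ... | no  _  | no ¬Q0 = contradiction Q0 ¬Q0
  ... | no  _  | yes _  = s≤s (count-mono (P? ∘ suc) (Q? ∘ suc) P⊆Q)
  count-< {suc m} P? Q? P⊆Q {suc x} ¬Px Qx with P? zero | Q? zero
  ... | yes _  | yes _  = s≤s (count-< (P? ∘ suc) (Q? ∘ suc) P⊆Q ¬Px Qx)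
  ... | no  _  | yes _  = ℕₚ.m≤n⇒m≤1+n (count-< (P? ∘ suc) (Q? ∘ suc) P⊆Q ¬Px Qx)
  ... | no  _  | no  _  = count-< (P? ∘ suc) (Q? ∘ suc) P⊆Q ¬Px Qx
  ... | yes P0 | no ¬Q0 = contradiction (P⊆Q P0) ¬Q0

module Cosets {H G : FinGroup} (ι : SubgroupEmbedding H G) where
  open Graphs
  open FiniteGroups
  open FinSubsets
  open SubgroupEmbedding ι
  open FinGroupProperties G
  open SubgroupEmbeddingProperties ι
  private module H = FinGroupProperties H
  open import Data.Fin using (Fin′; inject; fromℕ<; _<_)
  open import Data.Fin.Properties as Finₚ using (_≟_)
  open import Data.Bool using (true; false)
  import Data.Bool.Properties as Boolₚ
  open import Data.Product using (∃; proj₁; proj₂)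
  open import Function using (_∘_)
  open import Function.Bundles using (_↔_; mk↔ₛ′)
  open import Relation.Binary using (Rel; tri<; tri≈; tri>)
  open import Relation.Binary.PropositionalEquality
  open import Relation.Nullary using (¬?; yes; no; Dec; contradiction)
  open import Relation.Nullary.Decidable using (decidable-stable)

  Image : Pred (Fin (order G)) 0ℓ
  Image g = ∃ λ a → φ a ≡ g

  image? : Decidable Image
  image? g = Finₚ.any? (λ a → φ a ≟ g)

  image-ε : Image ε
  image-ε = H.ε , φ-ε

  image-⁻¹ : ∀ {x} → Image x → Image (x ⁻¹)
  image-⁻¹ (a , refl) = a H.⁻¹ , φ-⁻¹ a

  image-// : ∀ {x y} → Image x → Image y → Image (x ∙ y ⁻¹)
  image-// (a , refl) (b , refl) = a H.∙ b H.⁻¹ , φ-// a b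

  _~_ : Rel (Fin (order G)) 0ℓ
  x ~ y = Image (x ∙ y ⁻¹)

  _~?_ : ∀ x y → Dec (x ~ y)
  x ~? y = image? (x ∙ y ⁻¹)

  ~-refl : ∀ {x} → x ~ x
  ~-refl {x} = subst Image (sym (inverseʳ x)) image-ε

  ~-sym : ∀ {x y} → x ~ y → y ~ x
  ~-sym {x} {y} x~y = subst Image (⁻¹-anti-homo-// x y) (image-⁻¹ x~y)

  ~-trans : ∀ {x y z} → x ~ y → y ~ z → x ~ z
  ~-trans {x} {y} {z} x~y y~z = subst Image (trans (cong ((x ∙ y ⁻¹) ∙_) (⁻¹-involutive _)) (//-chain x y z))
    (image-// x~y (image-⁻¹ y~z))

  -- The canonical representative of a coset is its least element.
  IsLeastIn : Fin (order G) → Fin (order G) → Set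
  IsLeastIn x c = x ~ c × ∀ (j : Fin′ c) → ¬ (x ~ inject j)

  least : ∀ x → ∃ (IsLeastIn x)
  least x with Finₚ.¬∀⟶∃¬-smallest _ (λ y → ¬ (x ~ y)) (λ y → ¬? (x ~? y)) (λ none → none x ~-refl)
  ... | c , ¬¬x~c , below = c , decidable-stable (x ~? c) ¬¬x~c , below

  inject-fromℕ< : ∀ {n} {i j : Fin n} (i<j : i < j) → inject (fromℕ< i<j) ≡ i
  inject-fromℕ< i<j = Finₚ.toℕ-injective (trans (Finₚ.toℕ-inject (fromℕ< i<j)) (Finₚ.toℕ-fromℕ< i<j))

  least-unique : ∀ {x y c d} → x ~ y → IsLeastIn x c → IsLeastIn y d → c ≡ d
  least-unique {x} {y} {c} {d} x~y (x~c , below-c) (y~d , below-d) with Finₚ.<-cmp c d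
  ... | tri≈ _ c≡d _ = c≡d
  ... | tri< c<d _ _ with () ← below-d (fromℕ< c<d) (subst (y ~_) (sym (inject-fromℕ< c<d)) (~-trans (~-sym x~y) x~c))
  ... | tri> _ _ d<c with () ← below-c (fromℕ< d<c) (subst (x ~_) (sym (inject-fromℕ< d<c)) (~-trans x~y y~d))

  canon : Fin (order G) → Fin (order G)
  canon x = proj₁ (least x)

  canon-~ : ∀ x → x ~ canon x
  canon-~ x = proj₁ (proj₂ (least x))

  canon-cong : ∀ {x y} → x ~ y → canon x ≡ canon y
  canon-cong {x} {y} x~y = least-unique x~y (proj₂ (least x)) (proj₂ (least y))

  private
    reps : Enumeration (λ g → canon g ≡ g)
    reps = enumerate (λ g → canon g ≟ g)
    module reps = Enumeration reps

  index : ℕ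
  index = reps.size

  rep : Fin index → Fin (order G)
  rep = reps.elem

  cosetOf : Fin (order G) → Fin index
  cosetOf x = proj₁ (reps.complete (canon-cong (~-sym (canon-~ x))))

  rep-cosetOf : ∀ x → rep (cosetOf x) ≡ canon x
  rep-cosetOf x = proj₂ (reps.complete (canon-cong (~-sym (canon-~ x))))

  canon-φ∙rep : ∀ c a → canon (φ a ∙ rep c) ≡ rep c
  canon-φ∙rep c a = trans (canon-cong (a , sym (//-rightDividesʳ (rep c) (φ a)))) (reps.sound c)

  cosets : (Fin index × Fin (order H)) ↔ Fin (order G)
  cosets = mk↔ₛ′ (λ (c , a) → φ a ∙ rep c) (λ x → cosetOf x , proj₁ (canon-~ x)) to∘from from∘to
    where
    to∘from : ∀ x → φ (proj₁ (canon-~ x)) ∙ rep (cosetOf x) ≡ x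
    to∘from x = trans (cong₂ _∙_ (proj₂ (canon-~ x)) (rep-cosetOf x)) (//-rightDividesˡ (canon x) x)
    from∘to : ∀ ((c , a) : Fin index × Fin (order H)) →
      (cosetOf (φ a ∙ rep c) , proj₁ (canon-~ (φ a ∙ rep c))) ≡ (c , a)
    from∘to (c , a) = cong₂ _,_
      (reps.injective (trans (rep-cosetOf (φ a ∙ rep c)) (canon-φ∙rep c a)))
      (injective (trans (proj₂ (canon-~ (φ a ∙ rep c)))
        (trans (cong (λ r → (φ a ∙ rep c) ∙ r ⁻¹) (canon-φ∙rep c a)) (//-rightDividesʳ (rep c) (φ a)))))

  Cay-cosets : ∀ (S : Fin (order G) → Bool) → (∀ {g} → S g ≡ true → Image g) →
    copies index (Cay H (S ∘ φ)) ≅ Cay G S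
  Cay-cosets S S⊆image = copies-≅ {Γ = Cay G S} cosets within across
    where
    within : ∀ c a b → Cay G S (φ a ∙ rep c) (φ b ∙ rep c) ≡ Cay H (S ∘ φ) a b
    within c a b = trans (Cay-translate S (φ a) (φ b) (rep c)) (sym (Cay-induced S a b))
    across : ∀ {c c′} a b → c ≢ c′ → Cay G S (φ a ∙ rep c) (φ b ∙ rep c′) ≡ false
    across {c} {c′} a b c≢c′ = Boolₚ.¬-not λ edge → c≢c′ (reps.injective
      (trans (sym (canon-φ∙rep c a)) (trans (canon-cong (S⊆image edge)) (canon-φ∙rep c′ b))))

  extend : (Fin (order H) → Bool) → Fin (order G) → Bool
  extend S g with image? g
  ... | yes (a , _) = S a
  ... | no  _       = false

  extend-φ : ∀ S a → extend S (φ a) ≡ S a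
  extend-φ S a with image? (φ a)
  ... | yes (a′ , φa′≡φa) = cong S (injective φa′≡φa)
  ... | no  φa∉image      = contradiction (a , refl) φa∉image

  extend⊆image : ∀ S {g} → extend S g ≡ true → Image g
  extend⊆image S {g} Sg with image? g
  ... | yes g∈image = g∈image
  ... | no  _       with () ← Sg

  extend-connectionSet : ∀ {S} → IsConnectionSet H S → IsConnectionSet G (extend S)
  extend-connectionSet {S} (S-ε , S-⁻¹) = trans (cong (extend S) (sym φ-ε)) (trans (extend-φ S H.ε) S-ε) , extend-⁻¹
    where
    extend-⁻¹ : ∀ g → extend S (g ⁻¹) ≡ extend S g
    extend-⁻¹ g with image? g
    ... | yes (a , refl) = trans (cong (extend S) (sym (φ-⁻¹ a))) (trans (extend-φ S (a H.⁻¹)) (S-⁻¹ a))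
    ... | no  g∉image with image? (g ⁻¹)
    ...   | yes g⁻¹∈image = contradiction (subst Image (⁻¹-involutive g) (image-⁻¹ g⁻¹∈image)) g∉image
    ...   | no  _         = refl

  Cay-extend : ∀ S → copies index (Cay H S) ≅ Cay G (extend S)
  Cay-extend S = ≅-trans {B = copies index (Cay H (extend S ∘ φ))} {C = Cay G (extend S)}
    (copies-cong index (≗⇒≅ λ a b → sym (extend-φ S (a H.∙ b H.⁻¹))))
    (Cay-cosets (extend S) (extend⊆image S))

module Reachability {n} (Γ : Graph n) (r : Fin n) where
  open Graphs using (Edge)
  open FinSubsets using (count; count-≤; count-<)
  open import Data.Nat as ℕ using (zero; suc; _≤_; z≤n; s≤s)
  import Data.Nat.Properties as ℕₚ
  open import Data.Fin.Properties as Finₚ using (_≟_; any?; all?)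
  open import Data.Bool using (true)
  import Data.Bool.Properties as Boolₚ
  open import Data.Sum using (_⊎_; inj₁; inj₂)
  open import Data.Product using (∃)
  open import Relation.Binary.Construct.Closure.ReflexiveTransitive using (Star; ε; _◅_; _◅◅_)
  open import Relation.Binary.PropositionalEquality
  open import Relation.Nullary using (yes; no; contradiction; _⊎-dec_; _×-dec_; _→-dec_)
  open import Relation.Nullary.Decidable using (map′; decidable-stable)

  Reachable : Pred (Fin n) 0ℓ
  Reachable = Star (Edge Γ) r

  ReachableWithin : ℕ → Pred (Fin n) 0ℓ
  ReachableWithin zero    x = x ≡ r
  ReachableWithin (suc t) x = ReachableWithin t x ⊎ ∃ λ u → ReachableWithin t u × Edge Γ u x

  reachableWithin? : ∀ t → Decidable (ReachableWithin t)
  reachableWithin? zero    x = x ≟ r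
  reachableWithin? (suc t) x = reachableWithin? t x ⊎-dec any? (λ u → reachableWithin? t u ×-dec (Γ u x Boolₚ.≟ true))


  reachableWithin-root : ∀ t → ReachableWithin t r
  reachableWithin-root zero    = refl
  reachableWithin-root (suc t) = inj₁ (reachableWithin-root t)

  reachableWithin⇒reachable : ∀ t {x} → ReachableWithin t x → Reachable x
  reachableWithin⇒reachable zero    refl               = ε
  reachableWithin⇒reachable (suc t) (inj₁ x∈)          = reachableWithin⇒reachable t x∈
  reachableWithin⇒reachable (suc t) (inj₂ (u , u∈ , e)) = reachableWithin⇒reachable t u∈ ◅◅ (e ◅ ε)

  Stable : ℕ → Set
  Stable t = ∀ x → ReachableWithin (suc t) x → ReachableWithin t x

  stable-suc : ∀ {t} → Stable t → Stable (suc t)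
  stable-suc st x (inj₁ x∈)          = x∈
  stable-suc st x (inj₂ (u , u∈ , e)) = inj₂ (u , st u u∈ , e)

  -- Until the reachable sets stabilise, each step adds a vertex.
  stable-or-growing : ∀ t → Stable t ⊎ t ≤ count (reachableWithin? t)
  stable-or-growing zero    = inj₂ z≤n
  stable-or-growing (suc t) with all? (λ x → reachableWithin? (suc t) x →-dec reachableWithin? t x) | stable-or-growing t
  ... | yes st | _        = inj₁ (stable-suc st)
  ... | no ¬st | inj₁ st  = contradiction st ¬st
  ... | no ¬st | inj₂ t≤c with Finₚ.¬∀⟶∃¬ n _ (λ x → reachableWithin? (suc t) x →-dec reachableWithin? t x) ¬st
  ...   | x , ¬[new⇒old] = inj₂ (ℕₚ.<-≤-trans (s≤s t≤c)
          (count-< (reachableWithin? t) (reachableWithin? (suc t)) inj₁ (λ old → ¬[new⇒old] λ _ → old) new))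
    where
    new : ReachableWithin (suc t) x
    new = decidable-stable (reachableWithin? (suc t) x) (λ ¬new → ¬[new⇒old] λ new → contradiction new ¬new)

  stable : Stable (suc n)
  stable with stable-or-growing (suc n)
  ... | inj₁ st = st
  ... | inj₂ n<c = contradiction (ℕₚ.≤-trans n<c (count-≤ (reachableWithin? (suc n)))) (ℕₚ.n≮n n)

  reachable⇒reachableWithin : ∀ {x} → Reachable x → ReachableWithin (suc n) x
  reachable⇒reachableWithin = go (reachableWithin-root (suc n))
    where
    go : ∀ {u x} → ReachableWithin (suc n) u → Star (Edge Γ) u x → ReachableWithin (suc n) x
    go u∈ ε       = u∈
    go u∈ (e ◅ p) = go (stable _ (inj₂ (_ , u∈ , e))) p

  reachable? : Decidable Reachable
  reachable? x = map′ (reachableWithin⇒reachable (suc n)) reachable⇒reachableWithin (reachableWithin? (suc n) x)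

module SubgroupOf (G : FinGroup) {P : Pred (Fin (order G)) 0ℓ} (P? : Decidable P)
  (P-ε : P (FinGroup.ε G)) (P-// : ∀ {x y} → P x → P y → P (FinGroup._∙_ G x (FinGroup._⁻¹ G y))) where
  open FiniteGroups
  open FinGroupProperties G
  open FinSubsets
  open import Data.Product using (proj₁; proj₂)
  open import Relation.Binary.PropositionalEquality
  open ≡-Reasoning
  private
    module E = Enumeration (enumerate P?)
  open E public using (elem; sound; complete)

  P-⁻¹ : ∀ {x} → P x → P (x ⁻¹)
  P-⁻¹ {x} Px = subst P (identityˡ (x ⁻¹)) (P-// P-ε Px)

  P-∙ : ∀ {x y} → P x → P y → P (x ∙ y)
  P-∙ {x} {y} Px Py = subst P (cong (x ∙_) (⁻¹-involutive y)) (P-// Px (P-⁻¹ Py))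

  private
    indexOf : ∀ {x} → P x → Fin E.size
    indexOf Px = proj₁ (complete Px)

    elem-indexOf : ∀ {x} (Px : P x) → elem (indexOf Px) ≡ x
    elem-indexOf Px = proj₂ (complete Px)

    _∙′_ : Fin E.size → Fin E.size → Fin E.size
    a ∙′ b = indexOf (P-∙ (sound a) (sound b))

    ε′ : Fin E.size
    ε′ = indexOf P-ε

    _⁻¹′ : Fin E.size → Fin E.size
    a ⁻¹′ = indexOf (P-⁻¹ (sound a))

    elem-∙ : ∀ a b → elem (a ∙′ b) ≡ elem a ∙ elem b
    elem-∙ a b = elem-indexOf _

  subgroup : FinGroup
  subgroup = finGroup E.size _∙′_ ε′ _⁻¹′ assoc′ (identityˡ′ , identityʳ′) (inverseˡ′ , inverseʳ′)
    where
    assoc′ : ∀ a b c → (a ∙′ b) ∙′ c ≡ a ∙′ (b ∙′ c)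
    assoc′ a b c = E.injective (begin
      elem ((a ∙′ b) ∙′ c)          ≡⟨ trans (elem-∙ _ c) (cong (_∙ elem c) (elem-∙ a b)) ⟩
      (elem a ∙ elem b) ∙ elem c    ≡⟨ assoc (elem a) (elem b) (elem c) ⟩
      elem a ∙ (elem b ∙ elem c)    ≡⟨ trans (elem-∙ a _) (cong (elem a ∙_) (elem-∙ b c)) ⟨
      elem (a ∙′ (b ∙′ c))          ∎)
    identityˡ′ : ∀ a → ε′ ∙′ a ≡ a
    identityˡ′ a = E.injective (trans (elem-∙ ε′ a) (trans (cong (_∙ elem a) (elem-indexOf P-ε)) (identityˡ (elem a))))
    identityʳ′ : ∀ a → a ∙′ ε′ ≡ a
    identityʳ′ a = E.injective (trans (elem-∙ a ε′) (trans (cong (elem a ∙_) (elem-indexOf P-ε)) (identityʳ (elem a))))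
    inverseˡ′ : ∀ a → (a ⁻¹′) ∙′ a ≡ ε′
    inverseˡ′ a = E.injective (trans (elem-∙ (a ⁻¹′) a)
      (trans (cong (_∙ elem a) (elem-indexOf _)) (trans (inverseˡ (elem a)) (sym (elem-indexOf P-ε)))))
    inverseʳ′ : ∀ a → a ∙′ (a ⁻¹′) ≡ ε′
    inverseʳ′ a = E.injective (trans (elem-∙ a (a ⁻¹′))
      (trans (cong (elem a ∙_) (elem-indexOf _)) (trans (inverseʳ (elem a)) (sym (elem-indexOf P-ε)))))

  embedding : SubgroupEmbedding subgroup G
  embedding = record { φ = elem ; injective = E.injective ; hom = elem-∙ }

-- The connected component of ε in a Cayley graph is the Cayley graph of the subgroup generated by S.
module CayleyComponent {H : FinGroup} {S : Fin (order H) → Bool} (S-conn : IsConnectionSet H S) where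
  open Graphs
  open FiniteGroups
  open FinGroupProperties H
  open Reachability (Cay H S) ε
  open import Data.Bool using (true)
  open import Data.Product using (∃; proj₁; proj₂)
  open import Function using (_∘_)
  open import Relation.Binary.Construct.Closure.ReflexiveTransitive using (Star; _◅_; _◅◅_; gmap; reverse) renaming (ε to ε⋆)
  open import Relation.Binary.PropositionalEquality

  private
    X = Cay H S
    Path = Star (Edge X)

  translate : ∀ g {u v} → Path u v → Path (u ∙ g) (v ∙ g)
  translate g = gmap (_∙ g) (λ {u} {v} e → trans (Cay-translate S u v g) e)

  reverse-path : ∀ {u v} → Path u v → Path v u
  reverse-path = reverse (λ {u} {v} e → trans (proj₁ (Cay-simple S-conn) v u) e)

  reachable-// : ∀ {x y} → Reachable x → Reachable y → Reachable (x ∙ y ⁻¹)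
  reachable-// {x} {y} ε⇝x ε⇝y = ε⇝y⁻¹ ◅◅ y⁻¹⇝xy⁻¹
    where
    ε⇝y⁻¹ : Path ε (y ⁻¹)
    ε⇝y⁻¹ = reverse-path (subst₂ Path (identityˡ (y ⁻¹)) (inverseʳ y) (translate (y ⁻¹) ε⇝y))
    y⁻¹⇝xy⁻¹ : Path (y ⁻¹) (x ∙ y ⁻¹)
    y⁻¹⇝xy⁻¹ = subst (λ w → Path w (x ∙ y ⁻¹)) (identityˡ (y ⁻¹)) (translate (y ⁻¹) ε⇝x)

  S⊆reachable : ∀ {g} → S g ≡ true → Reachable g
  S⊆reachable {g} Sg = trans (cong S (identityˡ (g ⁻¹))) (trans (proj₂ S-conn g) Sg) ◅ ε⋆

  open SubgroupOf H reachable? ε⋆ reachable-// public using (subgroup; embedding)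
  open SubgroupOf H reachable? ε⋆ reachable-// using (elem; sound; complete)
  open SubgroupEmbeddingProperties embedding using (Cay-induced)

  component : Graph (order subgroup)
  component = Cay subgroup (S ∘ elem)

  component-connected : Connected component
  component-connected = root , reach
    where
    root = proj₁ (complete {ε} ε⋆)
    lift-edge : ∀ {a c} → Edge X (elem a) (elem c) → Edge component a c
    lift-edge {a} {c} = trans (Cay-induced S a c)
    lift : ∀ {a v} → Path (elem a) v → ∃ λ b → elem b ≡ v × Star (Edge component) a b
    lift {a} ε⋆ = a , refl , ε⋆
    lift {a} (e ◅ p) = extend (complete (sound a ◅◅ (e ◅ ε⋆))) e p
      where
      extend : ∀ {y v} → (∃ λ c → elem c ≡ y) → Edge X (elem a) y → Path y v →
               ∃ λ b → elem b ≡ v × Star (Edge component) a b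
      extend (c , refl) e p = let b , elem-b , q = lift p in b , elem-b , (lift-edge e ◅ q)
    reach : ∀ a → Star (Edge component) root a
    reach a = let b , elem-b , q = lift (subst (λ w → Path w (elem a)) (sym (proj₂ (complete {ε} ε⋆))) (sound a))
              in subst (Star (Edge component) root) (SubgroupEmbedding.injective embedding elem-b) q

  component-copies : copies (Cosets.index embedding) component ≅ Cay H S
  component-copies = Cosets.Cay-cosets embedding S (complete ∘ S⊆reachable)

module ConnectedCopies where
  open Graphs
  open import Data.Nat as ℕ using (zero; suc)
  import Data.Nat.Properties as ℕₚ
  open import Data.Fin using (zero; combine; quotient; remainder)
  open import Data.Fin.Properties using (combine-remQuot; nonZeroIndex)
  open import Data.Product using (proj₁; proj₂)
  open import Function using (_∘_)
  open import Function.Bundles using (Inverse; mk↔ₛ′)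
  open import Relation.Binary using (Rel)
  open import Relation.Binary.Construct.Closure.ReflexiveTransitive using (Star; fold)
  open import Relation.Binary.PropositionalEquality
  open Inverse using (to; from; strictlyInverseˡ; strictlyInverseʳ)

  Star-constant : ∀ {n} {A : Set} {E : Rel (Fin n) 0ℓ} (h : Fin n → A) →
    (∀ {u v} → E u v → h u ≡ h v) → ∀ {u v} → Star E u v → h u ≡ h v
  Star-constant h h-edge = fold (λ u v → h u ≡ h v) (λ e eq → trans (h-edge e) eq) refl

  -- An isomorphism maps the first copy of C, being connected, into a single copy of D, and back.
  connected-copies-cancel : ∀ {k l m m′} .{{_ : NonZero k}} {C : Graph m} {D : Graph m′} →
    Connected C → Connected D → copies k C ≅ copies l D → C ≅ D
  connected-copies-cancel {suc k} {l} {m} {m′} {C = C} {D} (a₀ , C-connected) (d₀ , D-connected) (σ , σ-edge) =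
    mk↔ₛ′ f g f∘g g∘f , f-edge
    where
    first : Fin m → Fin (suc k ℕ.* m)
    first = combine {suc k} {m} zero

    σ⁻¹-edge : ∀ u v → copies (suc k) C (from σ u) (from σ v) ≡ copies l D u v
    σ⁻¹-edge = proj₂ (≅-sym {A = copies (suc k) C} {B = copies l D} (σ , σ-edge))

    block : Fin m → Fin l
    block a = quotient m′ (to σ (first a))

    block-constant : ∀ a → block a₀ ≡ block a
    block-constant a = Star-constant block
      (λ {a} {b} ab → copies-edge⇒quotient≡ l D (trans (σ-edge (first a) (first b)) (trans (copies-within (suc k) C zero a b) ab)))
      (C-connected a)

    f : Fin m → Fin m′
    f a = remainder {l} m′ (to σ (first a))

    σ-first : ∀ a → to σ (first a) ≡ combine (block a₀) (f a)
    σ-first a = trans (sym (combine-remQuot {l} m′ (to σ (first a)))) (cong (λ c → combine c (f a)) (sym (block-constant a)))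

    f-edge : ∀ a b → D (f a) (f b) ≡ C a b
    f-edge a b = begin
      D (f a) (f b)                                            ≡⟨ copies-within l D (block a₀) (f a) (f b) ⟨
      copies l D (combine (block a₀) (f a)) (combine (block a₀) (f b)) ≡⟨ cong₂ (copies l D) (σ-first a) (σ-first b) ⟨
      copies l D (to σ (first a)) (to σ (first b))             ≡⟨ σ-edge (first a) (first b) ⟩
      copies (suc k) C (first a) (first b)                     ≡⟨ copies-within (suc k) C zero a b ⟩
      C a b                                                    ∎
      where open ≡-Reasoning

    g : Fin m′ → Fin m
    g b = remainder {suc k} m (from σ (combine (block a₀) b))

    block⁻¹ : Fin m′ → Fin (suc k)
    block⁻¹ b = quotient m (from σ (combine (block a₀) b))

    block⁻¹-constant : ∀ b → block⁻¹ d₀ ≡ block⁻¹ b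
    block⁻¹-constant b = Star-constant block⁻¹
      (λ {b} {b′} bb′ → copies-edge⇒quotient≡ (suc k) C
        (trans (σ⁻¹-edge _ _) (trans (copies-within l D (block a₀) b b′) bb′)))
      (D-connected b)

    σ⁻¹-σ-first : ∀ a → from σ (combine (block a₀) (f a)) ≡ first a
    σ⁻¹-σ-first a = trans (cong (from σ) (sym (σ-first a))) (strictlyInverseʳ σ (first a))

    block⁻¹≡zero : ∀ b → block⁻¹ b ≡ zero
    block⁻¹≡zero b = begin
      block⁻¹ b          ≡⟨ block⁻¹-constant b ⟨
      block⁻¹ d₀         ≡⟨ block⁻¹-constant (f a₀) ⟩
      block⁻¹ (f a₀)     ≡⟨ cong (quotient {suc k} m) (σ⁻¹-σ-first a₀) ⟩
      quotient {suc k} m (first a₀) ≡⟨ quotient-combine zero a₀ ⟩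
      zero               ∎
      where open ≡-Reasoning

    σ⁻¹-first : ∀ b → from σ (combine (block a₀) b) ≡ first (g b)
    σ⁻¹-first b = trans (sym (combine-remQuot {suc k} m _)) (cong (λ c → combine c (g b)) (block⁻¹≡zero b))

    g∘f : ∀ a → g (f a) ≡ a
    g∘f a = trans (cong (remainder {suc k} m) (σ⁻¹-σ-first a)) (remainder-combine zero a)

    f∘g : ∀ b → f (g b) ≡ b
    f∘g b = trans (cong (remainder {l} m′ ∘ to σ) (sym (σ⁻¹-first b)))
      (trans (cong (remainder {l} m′) (strictlyInverseˡ σ _)) (remainder-combine (block a₀) b))

  Cay-copies-cancel : ∀ {H K : FinGroup} {S T} {k} .{{_ : NonZero k}} → IsConnectionSet H S → IsConnectionSet K T →
    copies k (Cay H S) ≅ copies k (Cay K T) → Cay H S ≅ Cay K T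
  Cay-copies-cancel {H} {K} {S} {T} {k} S-conn T-conn kX≅kY = begin
    Cay H S       ≅⟨ X.component-copies ⟨
    copies j X₀   ≅⟨ copies-cong j {X = X₀} {Y = Y₀} X₀≅Y₀ ⟩
    copies j Y₀   ≅⟨ ≡⇒copies≅ {X = Y₀} j≡j′ ⟩
    copies j′ Y₀  ≅⟨ Y.component-copies ⟩
    Cay K T       ∎
    where
    open ≅-Reasoning
    module X = CayleyComponent {H} {S} S-conn
    module Y = CayleyComponent {K} {T} T-conn
    X₀ = X.component
    Y₀ = Y.component
    j  = Cosets.index X.embedding
    j′ = Cosets.index Y.embedding
    instance
      j≢0 : NonZero j
      j≢0 = ℕₚ.m*n≢0⇒m≢0 j {{nonZeroIndex (from (proj₁ X.component-copies) (FinGroup.ε H))}}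
      j′≢0 : NonZero j′
      j′≢0 = ℕₚ.m*n≢0⇒m≢0 j′ {{nonZeroIndex (from (proj₁ Y.component-copies) (FinGroup.ε K))}}
    X₀≅Y₀ : X₀ ≅ Y₀
    X₀≅Y₀ = connected-copies-cancel {k ℕ.* j} {k ℕ.* j′} {{ℕₚ.m*n≢0 k j}} {C = X₀} {Y₀}
      X.component-connected Y.component-connected (begin
      copies (k ℕ.* j) X₀        ≅⟨ copies-flatten k j X₀ ⟩
      copies k (copies j X₀)     ≅⟨ copies-cong k {X = copies j X₀} {Y = Cay H S} X.component-copies ⟩
      copies k (Cay H S)         ≅⟨ kX≅kY ⟩
      copies k (Cay K T)         ≅⟨ copies-cong k {X = copies j′ Y₀} {Y = Cay K T} Y.component-copies ⟨
      copies k (copies j′ Y₀)    ≅⟨ copies-flatten k j′ Y₀ ⟨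
      copies (k ℕ.* j′) Y₀       ∎)
    |H|≡|K| : order H ≡ order K
    |H|≡|K| = ℕₚ.*-cancelˡ-≡ (order H) (order K) k (≅⇒≡ {A = copies k (Cay H S)} {B = copies k (Cay K T)} kX≅kY)
    j≡j′ : j ≡ j′
    j≡j′ = ℕₚ.*-cancelʳ-≡ j j′ (order X.subgroup) {{nonZeroIndex (proj₁ X.component-connected)}}
      (trans (≅⇒≡ {A = copies j X₀} {B = Cay H S} X.component-copies)
      (trans |H|≡|K|
      (trans (sym (≅⇒≡ {A = copies j′ Y₀} {B = Cay K T} Y.component-copies))
             (cong (j′ ℕ.*_) (sym (≅⇒≡ {A = X₀} {B = Y₀} X₀≅Y₀))))))

module CyclicGroup (n : ℕ) .{{_ : NonZero n}} where
  open FiniteGroups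
  open import Data.Nat as ℕ using (_∸_; _%_)
  import Data.Nat.Properties as ℕₚ
  open import Data.Nat.DivMod using (m%n<n; %-distribˡ-+; m%n%n≡m%n; m<n⇒m%n≡m; n%n≡0)
  open import Data.Fin using (toℕ; fromℕ<)
  import Data.Fin.Properties as Finₚ
  open import Relation.Binary.PropositionalEquality
  open ≡-Reasoning

  infixl 6 _+_

  _+_ : Fin n → Fin n → Fin n
  x + y = fromℕ< (m%n<n (toℕ x ℕ.+ toℕ y) n)

  -_ : Fin n → Fin n
  - x = fromℕ< (m%n<n (n ∸ toℕ x) n)

  0# : Fin n
  0# = fromℕ< (ℕ.>-nonZero⁻¹ n)

  toℕ-+ : ∀ x y → toℕ (x + y) ≡ (toℕ x ℕ.+ toℕ y) % n
  toℕ-+ x y = Finₚ.toℕ-fromℕ< _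

  toℕ-% : ∀ x → toℕ x % n ≡ toℕ x
  toℕ-% x = m<n⇒m%n≡m (Finₚ.toℕ<n x)

  %-absorbˡ : ∀ a b → (a % n ℕ.+ b) % n ≡ (a ℕ.+ b) % n
  %-absorbˡ a b = begin
    (a % n ℕ.+ b) % n           ≡⟨ %-distribˡ-+ (a % n) b n ⟩
    (a % n % n ℕ.+ b % n) % n   ≡⟨ cong (λ r → (r ℕ.+ b % n) % n) (m%n%n≡m%n a n) ⟩
    (a % n ℕ.+ b % n) % n       ≡⟨ %-distribˡ-+ a b n ⟨
    (a ℕ.+ b) % n               ∎

  +-comm : ∀ x y → x + y ≡ y + x
  +-comm x y = Finₚ.toℕ-injective (trans (toℕ-+ x y) (trans (cong (_% n) (ℕₚ.+-comm (toℕ x) (toℕ y))) (sym (toℕ-+ y x))))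

  +-assoc : ∀ x y z → (x + y) + z ≡ x + (y + z)
  +-assoc x y z = Finₚ.toℕ-injective (begin
    toℕ ((x + y) + z)                    ≡⟨ trans (toℕ-+ (x + y) z) (cong (λ r → (r ℕ.+ toℕ z) % n) (toℕ-+ x y)) ⟩
    ((toℕ x ℕ.+ toℕ y) % n ℕ.+ toℕ z) % n ≡⟨ %-absorbˡ (toℕ x ℕ.+ toℕ y) (toℕ z) ⟩
    (toℕ x ℕ.+ toℕ y ℕ.+ toℕ z) % n      ≡⟨ cong (_% n) (trans (ℕₚ.+-assoc (toℕ x) _ _) (ℕₚ.+-comm (toℕ x) _)) ⟩
    (toℕ y ℕ.+ toℕ z ℕ.+ toℕ x) % n      ≡⟨ %-absorbˡ (toℕ y ℕ.+ toℕ z) (toℕ x) ⟨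
    ((toℕ y ℕ.+ toℕ z) % n ℕ.+ toℕ x) % n ≡⟨ trans (toℕ-+ (y + z) x) (cong (λ r → (r ℕ.+ toℕ x) % n) (toℕ-+ y z)) ⟨
    toℕ ((y + z) + x)                    ≡⟨ cong toℕ (+-comm (y + z) x) ⟩
    toℕ (x + (y + z))                    ∎)

  +-identityˡ : ∀ x → 0# + x ≡ x
  +-identityˡ x = Finₚ.toℕ-injective (begin
    toℕ (0# + x)                ≡⟨ toℕ-+ 0# x ⟩
    (toℕ 0# ℕ.+ toℕ x) % n      ≡⟨ cong (λ r → (r ℕ.+ toℕ x) % n) (Finₚ.toℕ-fromℕ< _) ⟩
    toℕ x % n                   ≡⟨ toℕ-% x ⟩
    toℕ x                       ∎)

  -‿inverseˡ : ∀ x → (- x) + x ≡ 0#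
  -‿inverseˡ x = Finₚ.toℕ-injective (begin
    toℕ ((- x) + x)                      ≡⟨ toℕ-+ (- x) x ⟩
    (toℕ (- x) ℕ.+ toℕ x) % n            ≡⟨ cong (λ r → (r ℕ.+ toℕ x) % n) (Finₚ.toℕ-fromℕ< _) ⟩
    ((n ∸ toℕ x) % n ℕ.+ toℕ x) % n      ≡⟨ %-absorbˡ (n ∸ toℕ x) (toℕ x) ⟩
    (n ∸ toℕ x ℕ.+ toℕ x) % n            ≡⟨ cong (_% n) (ℕₚ.m∸n+n≡m (ℕₚ.<⇒≤ (Finₚ.toℕ<n x))) ⟩
    n % n                                ≡⟨ n%n≡0 n ⟩
    0                                    ≡⟨ Finₚ.toℕ-fromℕ< _ ⟨
    toℕ 0#                               ∎)

  ℤ/n : FinGroup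
  ℤ/n = finGroup n _+_ 0# -_ +-assoc
    (+-identityˡ , λ x → trans (+-comm x 0#) (+-identityˡ x))
    (-‿inverseˡ , λ x → trans (+-comm x (- x)) (-‿inverseˡ x))

module DirectProduct (A B : FinGroup) where
  open FiniteGroups
  open import Data.Nat as ℕ using ()
  open import Data.Fin using (combine; quotient; remainder)
  open import Data.Fin.Properties using (combine-surjective)
  open import Relation.Binary.PropositionalEquality
  open Graphs using (quotient-combine; remainder-combine)
  private
    module A = FinGroupProperties A
    module B = FinGroupProperties B
    p = order A
    q = order B

  infixl 7 _∙_
  infix  8 _⁻¹

  _∙_ : Fin (p ℕ.* q) → Fin (p ℕ.* q) → Fin (p ℕ.* q)
  u ∙ v = combine (quotient q u A.∙ quotient q v) (remainder {p} q u B.∙ remainder {p} q v)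

  _⁻¹ : Fin (p ℕ.* q) → Fin (p ℕ.* q)
  u ⁻¹ = combine (quotient q u A.⁻¹) (remainder {p} q u B.⁻¹)

  ε : Fin (p ℕ.* q)
  ε = combine A.ε B.ε

  ∙-combine : ∀ a b a′ b′ → combine a b ∙ combine a′ b′ ≡ combine (a A.∙ a′) (b B.∙ b′)
  ∙-combine a b a′ b′ = cong₂ combine (cong₂ A._∙_ (quotient-combine a b) (quotient-combine a′ b′))
                                      (cong₂ B._∙_ (remainder-combine a b) (remainder-combine a′ b′))

  ⁻¹-combine : ∀ a b → combine a b ⁻¹ ≡ combine (a A.⁻¹) (b B.⁻¹)
  ⁻¹-combine a b = cong₂ combine (cong A._⁻¹ (quotient-combine a b)) (cong B._⁻¹ (remainder-combine a b))

  assoc : ∀ u v w → (u ∙ v) ∙ w ≡ u ∙ (v ∙ w)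
  assoc u v w with combine-surjective {p} {q} u | combine-surjective {p} {q} v | combine-surjective {p} {q} w
  ... | a , b , refl | a′ , b′ , refl | a″ , b″ , refl = begin
    (combine a b ∙ combine a′ b′) ∙ combine a″ b″          ≡⟨ cong (_∙ combine a″ b″) (∙-combine a b a′ b′) ⟩
    combine (a A.∙ a′) (b B.∙ b′) ∙ combine a″ b″          ≡⟨ ∙-combine _ _ a″ b″ ⟩
    combine ((a A.∙ a′) A.∙ a″) ((b B.∙ b′) B.∙ b″)       ≡⟨ cong₂ combine (A.assoc a a′ a″) (B.assoc b b′ b″) ⟩
    combine (a A.∙ (a′ A.∙ a″)) (b B.∙ (b′ B.∙ b″))       ≡⟨ ∙-combine a b _ _ ⟨
    combine a b ∙ combine (a′ A.∙ a″) (b′ B.∙ b″)          ≡⟨ cong (combine a b ∙_) (∙-combine a′ b′ a″ b″) ⟨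
    combine a b ∙ (combine a′ b′ ∙ combine a″ b″)          ∎
    where open ≡-Reasoning

  identityˡ : ∀ u → ε ∙ u ≡ u
  identityˡ u with combine-surjective {p} {q} u
  ... | a , b , refl = trans (∙-combine A.ε B.ε a b) (cong₂ combine (A.identityˡ a) (B.identityˡ b))

  identityʳ : ∀ u → u ∙ ε ≡ u
  identityʳ u with combine-surjective {p} {q} u
  ... | a , b , refl = trans (∙-combine a b A.ε B.ε) (cong₂ combine (A.identityʳ a) (B.identityʳ b))

  inverseˡ : ∀ u → u ⁻¹ ∙ u ≡ ε
  inverseˡ u with combine-surjective {p} {q} u
  ... | a , b , refl = trans (cong (_∙ combine a b) (⁻¹-combine a b))
    (trans (∙-combine _ _ a b) (cong₂ combine (A.inverseˡ a) (B.inverseˡ b)))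

  inverseʳ : ∀ u → u ∙ u ⁻¹ ≡ ε
  inverseʳ u with combine-surjective {p} {q} u
  ... | a , b , refl = trans (cong (combine a b ∙_) (⁻¹-combine a b))
    (trans (∙-combine a b _ _) (cong₂ combine (A.inverseʳ a) (B.inverseʳ b)))

  A×B : FinGroup
  A×B = finGroup (p ℕ.* q) _∙_ ε _⁻¹ assoc (identityˡ , identityʳ) (inverseˡ , inverseʳ)

module CopiesOfCayley (k : ℕ) .{{_ : NonZero k}} (K : FinGroup) (T : Fin (order K) → Bool) where
  open Graphs
  open FiniteGroups
  open import Data.Nat as ℕ using ()
  open import Data.Fin using (combine; quotient; remainder)
  open import Data.Fin.Properties as Finₚ using (_≟_; *↔×; combine-surjective)
  open import Data.Bool using (false; _∧_)
  open import Function.Bundles using (_⇔_; mk⇔)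
  open import Function.Properties.Inverse using (↔-sym)
  open import Relation.Binary.PropositionalEquality
  open import Relation.Nullary using (does)
  open import Relation.Nullary.Decidable using (dec-true; dec-false; does-⇔)
  open CyclicGroup k using (ℤ/n)
  open DirectProduct ℤ/n K using (A×B; ∙-combine; ⁻¹-combine)
  private
    module Z = FinGroupProperties ℤ/n
    module K = FinGroupProperties K

  L : FinGroup
  L = A×B

  T′ : Fin (order L) → Bool
  T′ u = does (quotient (order K) u ≟ Z.ε) ∧ T (remainder {k} (order K) u)

  T′-combine : ∀ c a → T′ (combine c a) ≡ does (c ≟ Z.ε) ∧ T a
  T′-combine c a = cong₂ (λ c a → does (c ≟ Z.ε) ∧ T a) (quotient-combine c a) (remainder-combine c a)

  Cay-combine : ∀ c a c′ b → Cay L T′ (combine c a) (combine c′ b) ≡ does (c Z.∙ c′ Z.⁻¹ ≟ Z.ε) ∧ Cay K T a b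
  Cay-combine c a c′ b =
    trans (cong T′ (trans (cong (combine c a ∙L_) (⁻¹-combine c′ b)) (∙-combine c a _ _))) (T′-combine _ _)
    where _∙L_ = FinGroup._∙_ L

  T′-connectionSet : IsConnectionSet K T → IsConnectionSet L T′
  T′-connectionSet (T-ε , T-⁻¹) = trans (T′-combine Z.ε K.ε) (cong₂ _∧_ (dec-true (Z.ε ≟ Z.ε) refl) T-ε) , T′-⁻¹
    where
    T′-⁻¹ : ∀ u → T′ (FinGroup._⁻¹ L u) ≡ T′ u
    T′-⁻¹ u with combine-surjective {k} {order K} u
    ... | c , a , refl = begin
      T′ (FinGroup._⁻¹ L (combine c a))   ≡⟨ cong T′ (⁻¹-combine c a) ⟩
      T′ (combine (c Z.⁻¹) (a K.⁻¹))       ≡⟨ T′-combine _ _ ⟩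
      does (c Z.⁻¹ ≟ Z.ε) ∧ T (a K.⁻¹)     ≡⟨ cong₂ _∧_ (does-⇔ c⁻¹≡ε⇔c≡ε (c Z.⁻¹ ≟ Z.ε) (c ≟ Z.ε)) (T-⁻¹ a) ⟩
      does (c ≟ Z.ε) ∧ T a                 ≡⟨ T′-combine c a ⟨
      T′ (combine c a)                     ∎
      where
      open ≡-Reasoning
      c⁻¹≡ε⇔c≡ε : c Z.⁻¹ ≡ Z.ε ⇔ c ≡ Z.ε
      c⁻¹≡ε⇔c≡ε = mk⇔ (λ eq → Z.⁻¹-injective (trans eq (sym Z.ε⁻¹≈ε))) (λ eq → trans (cong Z._⁻¹ eq) Z.ε⁻¹≈ε)

  copies-Cay : copies k (Cay K T) ≅ Cay L T′
  copies-Cay = copies-≅ {Γ = Cay L T′} (↔-sym *↔×) within across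
    where
    within : ∀ c a b → Cay L T′ (combine c a) (combine c b) ≡ Cay K T a b
    within c a b = trans (Cay-combine c a c b) (cong (_∧ Cay K T a b) (dec-true (_ ≟ Z.ε) (Z.inverseʳ c)))
    across : ∀ {c c′} a b → c ≢ c′ → Cay L T′ (combine c a) (combine c′ b) ≡ false
    across {c} {c′} a b c≢c′ =
      trans (Cay-combine c a c′ b)
        (cong (_∧ Cay K T a b) (dec-false (_ ≟ Z.ε) (λ eq → c≢c′ (Z.x∙y⁻¹≈ε⇒x≈y c c′ eq))))

module _ where
  open Graphs
  open FirstReturn
  open FiniteGroups
  open ConnectedCopies
  open import Data.Nat using (zero; suc)
  open import Function.Bundles using (Inverse)
  open import Relation.Binary.PropositionalEquality using (refl)
  open ≅-Reasoning

  DS-subgroup : ∀ {G H} → SubgroupEmbedding H G → DS G → DS H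
  DS-subgroup {G} {H} ι DS-G S S-conn _ Γ Γ-simple X~Γ@(refl , _) = cancel index (Cay-extend S)
    where
    open Cosets ι
    X = Cay H S
    cancel : ∀ k → copies k X ≅ Cay G (extend S) → X ≅ Γ
    cancel zero    (σ , _) with () ← Inverse.from σ (FinGroup.ε G)
    cancel (suc k) kX≅CayG = ⊕-cancelʳ {X = X} {Γ} {R} (begin
      X ⊕ R             ≅⟨ kX≅CayG ⟩
      Cay G (extend S)  ≅⟨ CayG≅Γ⊕R ⟩
      Γ ⊕ R             ∎)
      where
      R = copies k X
      CayG≅Γ⊕R : Cay G (extend S) ≅ (Γ ⊕ R)
      CayG≅Γ⊕R = DS-G (extend S) (extend-connectionSet S-conn) _ (Γ ⊕ R)
        (⊕-simple Γ-simple (copies-simple k (FinGroupProperties.Cay-simple H S-conn)))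
        (Cospectral-trans (Cospectral-sym (≅⇒Cospectral kX≅CayG)) (Cospectral-⊕ X~Γ Cospectral-refl))

  CayDS-subgroup : ∀ {G H} → SubgroupEmbedding H G → CayDS G → CayDS H
  CayDS-subgroup {G} {H} ι CayDS-G S S-conn K T T-conn X~Y = cancel index (Cay-extend S)
    where
    open Cosets ι
    X = Cay H S
    Y = Cay K T
    cancel : ∀ k → copies k X ≅ Cay G (extend S) → X ≅ Y
    cancel zero      (σ , _) with () ← Inverse.from σ (FinGroup.ε G)
    cancel k@(suc _) kX≅CayG = Cay-copies-cancel {H = H} {K} {S} {T} {k} S-conn T-conn (begin
      copies k X        ≅⟨ kX≅CayG ⟩
      Cay G (extend S)  ≅⟨ CayG≅CayL ⟩
      Cay L T′          ≅⟨ copies-Cay ⟨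
      copies k Y        ∎)
      where
      open CopiesOfCayley k K T
      CayG≅CayL : Cay G (extend S) ≅ Cay L T′
      CayG≅CayL = CayDS-G (extend S) (extend-connectionSet S-conn) L T′ (T′-connectionSet T-conn)
        (Cospectral-trans (Cospectral-sym (≅⇒Cospectral kX≅CayG))
          (Cospectral-trans (Cospectral-copies k X~Y) (≅⇒Cospectral copies-Cay)))

proposition2p1 : (G H : FinGroup) → SubgroupEmbedding H G →
    ((¬ DS H → ¬ DS G) × (¬ CayDS H → ¬ CayDS G))
      × ((DS G → DS H) × (CayDS G → CayDS H))
proposition2p1 G H ι =
  (contraposition (DS-subgroup ι) , contraposition (CayDS-subgroup ι)) , (DS-subgroup ι , CayDS-subgroup ι)
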